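{- Let $F$ be a field, let $r\geqslant 1$, and let $A_r$ denote the adjacency matrix of the butterfly network $\mathrm{BF}(r)$ over $F$. Then \[\operatorname{rank}(A_r)\leqslant(r+1)2^r-\frac19\left[(3r+7)2^r+2(-1)^r\right]=\frac29\left[(3r+1)2^{r}-(-1)^r\right].\]
   Context: The butterfly network $\mathrm{BF}(r)$ has vertex set $\bigcup_{i=0}^r V_i$ with $V_i=\{(x,i): x\in\{0,\dots,2^r-1\}\}$ (so $(r+1)2^r$ vertices), each $x$ identified with the binary vector $(x_1,\dots,x_r)$ with $x=\sum_j x_j2^{j-1}$; edges join $(x,i-1)$ and $(y,i)$ for $1\leqslant i\leqslant r$ and $y\in\{x,x+e_i\}$ (addition modulo 2, $e_i$ the $i$-th unit vector). The adjacency matrix over $F$ has entry $1$ for adjacent pairs and $0$ otherwise (including the diagonal). -}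

module Defs where

open import Level using (Level; _⊔_) renaming (suc to lsuc)
open import Algebra.Bundles using (CommutativeRing)
open import Data.Nat using (ℕ; zero; suc; _^_; _∸_; _≡ᵇ_; _/_; _%_)
open import Data.Nat as ℕ using ()
open import Data.Integer as ℤ using (ℤ; +_)
open import Data.Rational as ℚ using (ℚ)
open import Data.Fin using (Fin; toℕ)
open import Data.Bool using (Bool; true; false; if_then_else_; _∧_; _∨_)
open import Data.Product using (_×_; _,_; Σ)
open import Relation.Nullary using (¬_)

record Field (c ℓ : Level) : Set (lsuc (c ⊔ ℓ)) where
  field
    commutativeRing : CommutativeRing c ℓ
  open CommutativeRing commutativeRing public
  field
    0≉1     : ¬ (0# ≈ 1#)
    inverse : ∀ x → ¬ (x ≈ 0#) → Σ Carrier λ y → (x * y) ≈ 1#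

Vertex : ℕ → Set
Vertex r = Fin (2 ^ r) × Fin (suc r)

-- the j-th binary digit (0-indexed) of x, i.e. x_{j+1} in the paper
bit : ℕ → ℕ → ℕ
bit x zero = x % 2
bit x (suc j) = bit (x / 2) j

-- x + e_i (mod 2) for 1 ≤ i: flip the i-th binary coordinate x_i,
-- which has weight 2^(i-1)
flipCoord : ℕ → ℕ → ℕ
flipCoord x i = if bit x (i ∸ 1) ≡ᵇ 0 then x ℕ.+ 2 ^ (i ∸ 1) else x ∸ 2 ^ (i ∸ 1)

-- directed edge test: (x , i-1) — (y , i) with y ∈ {x , x + e_i}, 1 ≤ i ≤ r
edgeUp : ℕ → ℕ → ℕ → ℕ → Bool
edgeUp x i' y i = (i ≡ᵇ suc i') ∧ ((y ≡ᵇ x) ∨ (y ≡ᵇ flipCoord x i))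

adjacent : (r : ℕ) → Vertex r → Vertex r → Bool
adjacent r (x , i) (y , j) =
  edgeUp (toℕ x) (toℕ i) (toℕ y) (toℕ j) ∨ edgeUp (toℕ y) (toℕ j) (toℕ x) (toℕ i)

adjMatrix : ∀ {c ℓ} (F : Field c ℓ) (r : ℕ) → Vertex r → Vertex r → Field.Carrier F
adjMatrix F r u v = if adjacent r u v then Field.1# F else Field.0# F

module _ {c ℓ} (F : Field c ℓ) where
  open Field F

  Σ[_] : (k : ℕ) → (Fin k → Carrier) → Carrier
  Σ[ zero ] f = 0#
  Σ[ suc k ] f = f Fin.zero + Σ[ k ] (λ j → f (Fin.suc j))

  LinearlyIndependent : {I : Set} (k : ℕ) → (Fin k → I → Carrier) → Set (c ⊔ ℓ)
  LinearlyIndependent {I} k v =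
    (a : Fin k → Carrier) →
    (∀ (i : I) → Σ[ k ] (λ j → a j * v j i) ≈ 0#) →
    ∀ j → a j ≈ 0#

  RankAtMost : {I J : Set} → (I → J → Carrier) → ℚ → Set (c ⊔ ℓ)
  RankAtMost {I} {J} M B =
    (k : ℕ) (col : Fin k → J) →
    LinearlyIndependent k (λ j i → M i (col j)) → ((+ k) ℚ./ 1) ℚ.≤ B

module Submission where

open import Defs

-- Row p of A is a linear combination of the rows before p (in the order of levels,
-- then of x) whenever p carries a "pivot vector": a vector y with y A = 0, y p = 1 and
-- all other nonzero entries before p. Then the rows that are not pivots span the row
-- space, so rank A ≤ #vertices - #pivots.
--
-- A vertex (x , ℓ) is a pivot if bit ℓ of x is 1 (or ℓ = r) and, read downwards
-- from ℓ, the bits of x form pairs 0 1 ending at some level i with a 1 or at i = 0.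
-- Its vector lives on the levels ℓ, ℓ - 2, …, i with alternating signs, and on each
-- level it is a product of one factor per bit of the vertex. A pair of neighbours
-- differing in bit c contributes the sum of the c-th factor over both digits: these
-- sums vanish at the two ends of the chain, and between consecutive levels the two
-- pairs meeting at a vertex cancel.
--
-- Counting: there are 2^(r - ℓ - 1) J(ℓ + 1) pivots on a level ℓ < r and J(r + 1) on
-- level r, J(n) = (2^n - (-1)^n) / 3 being the Jacobsthal numbers, which adds up to
-- [(3r + 7) 2^r + 2 (-1)^r] / 9.

module LinearAlgebra {c ℓ} (F : Field c ℓ) where

  open import Level using (_⊔_)
  open import Data.Nat as ℕ using (ℕ; zero; suc)
  import Data.Nat.Properties as ℕₚ
  open import Data.Fin using (Fin; zero; suc)
  open import Data.Fin.Properties using (punchInᵢ≢i)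
  open import Data.Vec.Functional using (Vector; removeAt)
  open import Data.List using (List; []; _∷_; length; map)
  open import Data.List.Properties using (length-map)
  open import Data.List.Relation.Unary.All as All using (All; []; _∷_)
  open import Data.List.Relation.Unary.All.Properties using (map⁻)
  open import Data.List.Relation.Binary.Permutation.Propositional as ↭ using (_↭_)
  open import Data.List.Relation.Binary.Permutation.Propositional.Properties using (All-resp-↭; ↭-length)
  open import Data.List.Membership.Propositional using (_∈_)
  open import Data.Product using (∃₂; _×_; _,_; proj₁; proj₂)
  open import Data.Sum using (_⊎_; inj₁; inj₂)
  open import Function using (_∘_)
  open import Data.Empty using (⊥; ⊥-elim)
  open import Relation.Nullary using (¬_; yes; no; contradiction)
  open import Relation.Nullary.Decidable using (¬¬-excluded-middle)
  open import Relation.Binary.PropositionalEquality as ≡ using (_≡_; _≢_)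

  ¬All⇒¬¬-split : ∀ {a p} {A : Set a} {P : A → Set p} (xs : List A) →
    ¬ All P xs → ¬ ¬ ∃₂ λ x ys → xs ↭ x ∷ ys × ¬ P x
  ¬All⇒¬¬-split [] ¬all = contradiction [] ¬all
  ¬All⇒¬¬-split (x ∷ xs) ¬all ¬pick = ¬¬-excluded-middle λ where
    (no ¬px) → ¬pick (x , xs , ↭.refl , ¬px)
    (yes px) → ¬All⇒¬¬-split xs (¬all ∘ (px ∷_)) λ (y , ys , xs↭ , ¬py) →
      ¬pick (y , x ∷ ys , ↭.trans (↭.prep x xs↭) (↭.swap x y ↭.refl) , ¬py)

  open Field F hiding (zero)
  open import Algebra.Properties.Semiring.Sum semiring public
  open import Algebra.Properties.Ring ring using (-‿distribˡ-*)
  open import Relation.Binary.Reasoning.Setoid setoid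

  Σ≈sum : ∀ k (f : Vector Carrier k) → Σ[_] F k f ≈ sum f
  Σ≈sum zero f = refl
  Σ≈sum (suc k) f = +-congˡ (Σ≈sum k (f ∘ suc))

  sum-zero : ∀ {k} {f : Vector Carrier k} → (∀ j → f j ≈ 0#) → sum f ≈ 0#
  sum-zero {k} f≈0 = trans (sum-cong-≋ f≈0) (sum-replicate-zero k)

  sum-single-support : ∀ {k} (i : Fin k) (f : Vector Carrier k) →
    (∀ j → j ≢ i → f j ≈ 0#) → sum f ≈ f i
  sum-single-support {suc k} i f f≈0 = begin
    sum f                      ≈⟨ sum-remove f ⟩
    f i + sum (removeAt f i)   ≈⟨ +-congˡ (sum-zero (λ j → f≈0 _ (punchInᵢ≢i i j))) ⟩
    f i + 0#                   ≈⟨ +-identityʳ (f i) ⟩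
    f i                        ∎

  x∙yz≈y∙xz : ∀ x y z → x * (y * z) ≈ y * (x * z)
  x∙yz≈y∙xz x y z = trans (sym (*-assoc x y z)) (trans (*-congʳ (*-comm x y)) (*-assoc y x z))

  _·_ : ∀ {k} → Vector Carrier k → Vector Carrier k → Carrier
  _·_ {k} a ρ = ∑[ j < k ] (a j * ρ j)

  ·-linearʳ : ∀ {k} (a u v : Vector Carrier k) x → a · (λ j → u j + x * v j) ≈ a · u + x * (a · v)
  ·-linearʳ {k} a u v x = begin
    ∑[ j < k ] (a j * (u j + x * v j)) ≈⟨ sum-cong-≋ (λ j → distribˡ (a j) _ _) ⟩
    ∑[ j < k ] (a j * u j + a j * (x * v j)) ≈⟨ ∑-distrib-+ (λ j → a j * u j) (λ j → a j * (x * v j)) ⟩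
    a · u + ∑[ j < k ] (a j * (x * v j)) ≈⟨ +-congˡ (sum-cong-≋ λ j → x∙yz≈y∙xz (a j) x (v j)) ⟩
    a · u + ∑[ j < k ] (x * (a j * v j)) ≈⟨ +-congˡ (sym (*-distribˡ-sum x (λ j → a j * v j))) ⟩
    a · u + x * (a · v)                      ∎

  Solves : ∀ {k} → List (Vector Carrier k) → Vector Carrier k → Set (c ⊔ ℓ)
  Solves R a = All (λ ρ → a · ρ ≈ 0#) R

  Trivial : ∀ {k} → Vector Carrier k → Set ℓ
  Trivial a = ∀ j → a j ≈ 0#

  -- Gaussian elimination. Whether a pivot entry vanishes is not decidable in a
  -- setoid, so constructively the nontrivial solution is only double-negated.
  underdetermined-nontrivial : ∀ k (R : List (Vector Carrier k)) → length R ℕ.< k →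
    ¬ (∀ a → Solves R a → Trivial a)
  underdetermined-nontrivial (suc k) R len onlyTrivial = ¬¬-excluded-middle λ where
      (yes allZero) → 0≉1 (sym (onlyTrivial e₀ (All.map (λ {ρ} → e₀·ρ≈0 ρ) allZero) zero))
      (no ¬allZero) → ¬All⇒¬¬-split R ¬allZero λ (ρ₀ , R′ , R↭ , ρ₀≉0) →
        eliminate ρ₀ R′ R↭ ρ₀≉0
    where
    e₀ : Vector Carrier (suc k)
    e₀ zero = 1#
    e₀ (suc _) = 0#

    e₀·ρ≈0 : ∀ ρ → ρ zero ≈ 0# → e₀ · ρ ≈ 0#
    e₀·ρ≈0 ρ ρ₀≈0 = begin
      1# * ρ zero + ∑[ j < k ] (0# * ρ (suc j))
        ≈⟨ +-cong (*-identityˡ _) (sum-zero {k} (λ j → zeroˡ (ρ (suc j)))) ⟩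
      ρ zero + 0#  ≈⟨ +-identityʳ _ ⟩
      ρ zero       ≈⟨ ρ₀≈0 ⟩
      0#           ∎

    eliminate : ∀ ρ₀ R′ → R ↭ ρ₀ ∷ R′ → ¬ ρ₀ zero ≈ 0# → ⊥
    eliminate ρ₀ R′ R↭ ρ₀≉0 with inverse (ρ₀ zero) ρ₀≉0
    ... | p , ρ₀p≈1 = underdetermined-nontrivial k (map reduce R′) len′ λ b solves j →
          onlyTrivial (extend b) (extend-solves b solves) (suc j)
      where
      reduce : Vector Carrier (suc k) → Vector Carrier k
      reduce ρ j = ρ (suc j) + - (ρ zero * p) * ρ₀ (suc j)

      len′ : length (map reduce R′) ℕ.< k
      len′ rewrite length-map reduce R′ | ↭-length R↭ = ℕ.s<s⁻¹ len

      extend : Vector Carrier k → Vector Carrier (suc k)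
      extend b zero = - (p * (b · (ρ₀ ∘ suc)))
      extend b (suc j) = b j

      extend-· : ∀ b ρ → extend b · ρ ≈ b · reduce ρ
      extend-· b ρ = begin
        - (p * s₀) * ρ zero + b · (ρ ∘ suc)   ≈⟨ +-comm _ _ ⟩
        b · (ρ ∘ suc) + - (p * s₀) * ρ zero   ≈⟨ +-congˡ (trans (sym (-‿distribˡ-* _ _)) (-‿cong (*-comm _ _))) ⟩
        b · (ρ ∘ suc) + - (ρ zero * (p * s₀)) ≈⟨ +-congˡ (-‿cong (sym (*-assoc _ _ _))) ⟩
        b · (ρ ∘ suc) + - (ρ zero * p * s₀)   ≈⟨ +-congˡ (-‿distribˡ-* _ _) ⟩
        b · (ρ ∘ suc) + - (ρ zero * p) * s₀   ≈⟨ sym (·-linearʳ b (ρ ∘ suc) (ρ₀ ∘ suc) _) ⟩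
        b · reduce ρ                          ∎
        where
        s₀ : Carrier
        s₀ = b · (ρ₀ ∘ suc)

      reduce-pivot : ∀ j → reduce ρ₀ j ≈ 0#
      reduce-pivot j = begin
        ρ₀ (suc j) + - (ρ₀ zero * p) * ρ₀ (suc j) ≈⟨ +-congˡ (*-congʳ (-‿cong ρ₀p≈1)) ⟩
        ρ₀ (suc j) + - 1# * ρ₀ (suc j)            ≈⟨ +-congˡ (sym (-‿distribˡ-* _ _)) ⟩
        ρ₀ (suc j) + - (1# * ρ₀ (suc j))          ≈⟨ +-congˡ (-‿cong (*-identityˡ _)) ⟩
        ρ₀ (suc j) + - ρ₀ (suc j)                 ≈⟨ -‿inverseʳ _ ⟩
        0#                                        ∎

      extend-solves : ∀ b → Solves (map reduce R′) b → Solves R (extend b)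
      extend-solves b solves = All-resp-↭ (↭.↭-sym R↭) (pivot ∷ All.map (λ {ρ} → rest ρ) (map⁻ solves))
        where
        pivot : extend b · ρ₀ ≈ 0#
        pivot = trans (extend-· b ρ₀) (sum-zero λ j → trans (*-congˡ (reduce-pivot j)) (zeroʳ _))
        rest : ∀ ρ → b · reduce ρ ≈ 0# → extend b · ρ ≈ 0#
        rest ρ = trans (extend-· b ρ)

  ∑² : ∀ {A B} → (Fin A × Fin B → Carrier) → Carrier
  ∑² {A} {B} f = ∑[ a < A ] ∑[ b < B ] f (a , b)

  ∑²-cong : ∀ {A B} {f g : Fin A × Fin B → Carrier} → (∀ q → f q ≈ g q) → ∑² f ≈ ∑² g
  ∑²-cong f≈g = sum-cong-≋ λ a → sum-cong-≋ λ b → f≈g (a , b)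

  ∑²-comm : ∀ {A B k} (f : Fin A × Fin B → Fin k → Carrier) →
    ∑² (λ q → ∑[ j < k ] f q j) ≈ ∑[ j < k ] ∑² (λ q → f q j)
  ∑²-comm {A} {B} {k} f =
    trans (sum-cong-≋ λ a → ∑-comm (λ b → f (a , b))) (∑-comm λ a j → ∑[ b < B ] f (a , b) j)

  *-distribˡ-∑² : ∀ {A B} x (f : Fin A × Fin B → Carrier) → x * ∑² f ≈ ∑² (λ q → x * f q)
  *-distribˡ-∑² {A} {B} x f =
    trans (*-distribˡ-sum x (λ a → ∑[ b < B ] f (a , b)))
          (sum-cong-≋ λ a → *-distribˡ-sum x (λ b → f (a , b)))

  ∑²-single-support : ∀ {A B} (p : Fin A × Fin B) (f : Fin A × Fin B → Carrier) →
    (∀ q → q ≢ p → f q ≈ 0#) → ∑² f ≈ f p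
  ∑²-single-support {A} {B} (a , b) f f≈0 =
    trans (sum-single-support a (λ a′ → ∑[ b′ < B ] f (a′ , b′))
             λ a′ a′≢a → sum-zero {B} λ b′ → f≈0 (a′ , b′) (a′≢a ∘ ≡.cong proj₁))
          (sum-single-support b (λ b′ → f (a , b′))
             λ b′ b′≢b → f≈0 (a , b′) (b′≢b ∘ ≡.cong proj₂))

  module RankBound {A B : ℕ} {J : Set} (M : Fin A × Fin B → J → Carrier) (μ : Fin A × Fin B → ℕ) where

    record PivotRow (p : Fin A × Fin B) : Set (c ⊔ ℓ) where
      field
        coeff       : Fin A × Fin B → Carrier
        left-kernel : ∀ w → ∑² (λ q → coeff q * M q w) ≈ 0#
        at-pivot    : coeff p ≈ 1#
        triangular  : ∀ q → q ≢ p → coeff q ≈ 0# ⊎ μ q ℕ.< μ p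

    module _ {k} (col : Fin k → J) (a : Vector Carrier k) where

      image : Fin A × Fin B → Carrier
      image q = a · (λ j → M q (col j))

      left-kernel-kills-image : ∀ (y : Fin A × Fin B → Carrier) →
        (∀ w → ∑² (λ q → y q * M q w) ≈ 0#) → ∑² (λ q → y q * image q) ≈ 0#
      left-kernel-kills-image y ker = begin
        ∑² (λ q → y q * image q)
          ≈⟨ ∑²-cong (λ q → *-distribˡ-sum (y q) (λ j → a j * M q (col j))) ⟩
        ∑² (λ q → ∑[ j < k ] (y q * (a j * M q (col j))))
          ≈⟨ ∑²-comm (λ q j → y q * (a j * M q (col j))) ⟩
        ∑[ j < k ] ∑² (λ q → y q * (a j * M q (col j)))
          ≈⟨ sum-cong-≋ (λ j → ∑²-cong λ q → x∙yz≈y∙xz (y q) (a j) _) ⟩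
        ∑[ j < k ] ∑² (λ q → a j * (y q * M q (col j)))
          ≈⟨ sum-cong-≋ (λ j → sym (*-distribˡ-∑² (a j) (λ q → y q * M q (col j)))) ⟩
        ∑[ j < k ] (a j * ∑² (λ q → y q * M q (col j)))
          ≈⟨ sum-zero (λ j → trans (*-congˡ (ker (col j))) (zeroʳ (a j))) ⟩
        0# ∎

      image-vanishes : (L : List (Fin A × Fin B)) → (∀ p → p ∈ L ⊎ PivotRow p) →
        (∀ q → q ∈ L → image q ≈ 0#) → ∀ n p → μ p ℕ.< n → image p ≈ 0#
      image-vanishes L pivots onL (suc n) p μp<1+n with pivots p
      ... | inj₁ p∈L = onL p p∈L
      ... | inj₂ pivot = begin
        image p                      ≈⟨ sym (*-identityˡ _) ⟩
        1# * image p                 ≈⟨ *-congʳ (sym at-pivot) ⟩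
        coeff p * image p            ≈⟨ sym (∑²-single-support p (λ q → coeff q * image q) off-pivot) ⟩
        ∑² (λ q → coeff q * image q) ≈⟨ left-kernel-kills-image coeff left-kernel ⟩
        0#                           ∎
        where
        open PivotRow pivot
        off-pivot : ∀ q → q ≢ p → coeff q * image q ≈ 0#
        off-pivot q q≢p with triangular q q≢p
        ... | inj₁ yq≈0 = trans (*-congʳ yq≈0) (zeroˡ _)
        ... | inj₂ μq<μp =
          trans (*-congˡ (image-vanishes L pivots onL n q (ℕₚ.<-≤-trans μq<μp (ℕ.s≤s⁻¹ μp<1+n)))) (zeroʳ _)

    independent-columns≤non-pivots : (L : List (Fin A × Fin B)) → (∀ p → p ∈ L ⊎ PivotRow p) →
      ∀ k (col : Fin k → J) → LinearlyIndependent F k (λ j i → M i (col j)) → k ℕ.≤ length L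
    independent-columns≤non-pivots L pivots k col indep with length L ℕ.<? k
    ... | no  L≮k = ℕₚ.≮⇒≥ L≮k
    ... | yes L<k = ⊥-elim (underdetermined-nontrivial k rows len-rows λ a solves →
          indep a λ i → trans (Σ≈sum k _)
            (image-vanishes col a L pivots (λ q q∈L → All.lookup (map⁻ solves) q∈L)
                            (suc (μ i)) i ℕₚ.≤-refl))
      where
      rows : List (Vector Carrier k)
      rows = map (λ q j → M q (col j)) L
      len-rows : length rows ℕ.< k
      len-rows = ≡.subst (ℕ._< k) (≡.sym (length-map (λ q j → M q (col j)) L)) L<k

module Bits where

  open import Data.Nat
  open import Data.Nat.Properties
  open import Data.Nat.DivMod
  open import Data.Nat.Divisibility using (n∣m*n)
  open import Data.Product using (Σ; _×_; _,_; proj₁; proj₂)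
  open import Relation.Binary.PropositionalEquality
  open import Relation.Nullary using (contradiction)
  open import Function using (_∘_)

  bit<2 : ∀ x j → bit x j < 2
  bit<2 x zero = m%n<n x 2
  bit<2 x (suc j) = bit<2 (x / 2) j

  bit-cons-zero : ∀ {b} y → b < 2 → bit (b + y * 2) 0 ≡ b
  bit-cons-zero {b} y b<2 = trans ([m+kn]%n≡m%n b y 2) (m<n⇒m%n≡m b<2)

  bit-cons-suc : ∀ {b} y j → b < 2 → bit (b + y * 2) (suc j) ≡ bit y j
  bit-cons-suc {b} y j b<2 =
    cong (λ z → bit z j) (trans (+-distrib-/-∣ʳ b (n∣m*n y)) (cong₂ _+_ (m<n⇒m/n≡0 b<2) (m*n/n≡m y 2)))

  bit-decomposition : ∀ x → x ≡ bit x 0 + (x / 2) * 2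
  bit-decomposition x = m≡m%n+[m/n]*n x 2

  half< : ∀ n x → x < 2 ^ suc n → x / 2 < 2 ^ n
  half< n x x< = m<n*o⇒m/o<n (subst (x <_) (*-comm 2 (2 ^ n)) x<)

  bit-≥-width : ∀ n x j → x < 2 ^ n → n ≤ j → bit x j ≡ 0
  bit-≥-width zero _ j (s≤s z≤n) _ = bit-zero j
    where
    bit-zero : ∀ j → bit 0 j ≡ 0
    bit-zero zero = refl
    bit-zero (suc j) = bit-zero j
  bit-≥-width (suc n) x (suc j) x< (s≤s n≤j) = bit-≥-width n (x / 2) j (half< n x x<) n≤j

  bitwise-≤⇒≤ : ∀ n x y → x < 2 ^ n → (∀ j → j < n → bit x j ≤ bit y j) → x ≤ y
  bitwise-≤⇒≤ zero _ y (s≤s z≤n) _ = z≤n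
  bitwise-≤⇒≤ (suc n) x y x< bits≤ = begin
    x                     ≡⟨ bit-decomposition x ⟩
    bit x 0 + (x / 2) * 2 ≤⟨ +-mono-≤ (bits≤ 0 z<s) (*-monoˡ-≤ 2 halves≤) ⟩
    bit y 0 + (y / 2) * 2 ≡⟨ bit-decomposition y ⟨
    y                     ∎
    where
    open ≤-Reasoning
    halves≤ : x / 2 ≤ y / 2
    halves≤ = bitwise-≤⇒≤ n (x / 2) (y / 2) (half< n x x<) λ j j<n → bits≤ (suc j) (s<s j<n)

  set-bit : ∀ c x → bit x c ≡ 0 →
    bit (x + 2 ^ c) c ≡ 1 × (∀ j → j ≢ c → bit (x + 2 ^ c) j ≡ bit x j)
  set-bit zero x x₀≡0 = set , others
    where
    x+1≡ : x + 1 ≡ 1 + (x / 2) * 2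
    x+1≡ = trans (cong (_+ 1) (trans (bit-decomposition x) (cong (_+ (x / 2) * 2) x₀≡0))) (+-comm _ 1)
    set : bit (x + 1) 0 ≡ 1
    set rewrite x+1≡ = bit-cons-zero (x / 2) (s≤s (s≤s z≤n))
    others : ∀ j → j ≢ 0 → bit (x + 1) j ≡ bit x j
    others zero j≢0 = contradiction refl j≢0
    others (suc j) _ rewrite x+1≡ = bit-cons-suc (x / 2) j (s≤s (s≤s z≤n))
  set-bit (suc c) x x_c≡0 = set , others
    where
    b y : ℕ
    b = bit x 0
    y = x / 2
    x+≡ : x + 2 ^ suc c ≡ b + (y + 2 ^ c) * 2
    x+≡ = begin
      x + 2 ^ suc c           ≡⟨ cong (_+ 2 ^ suc c) (bit-decomposition x) ⟩
      b + y * 2 + 2 * 2 ^ c   ≡⟨ +-assoc b _ _ ⟩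
      b + (y * 2 + 2 * 2 ^ c) ≡⟨ cong (λ z → b + (y * 2 + z)) (*-comm 2 (2 ^ c)) ⟩
      b + (y * 2 + 2 ^ c * 2) ≡⟨ cong (b +_) (*-distribʳ-+ 2 y (2 ^ c)) ⟨
      b + (y + 2 ^ c) * 2     ∎
      where open ≡-Reasoning
    set : bit (x + 2 ^ suc c) (suc c) ≡ 1
    set rewrite x+≡ = trans (bit-cons-suc _ c (bit<2 x 0)) (proj₁ (set-bit c y x_c≡0))
    others : ∀ j → j ≢ suc c → bit (x + 2 ^ suc c) j ≡ bit x j
    others zero _ rewrite x+≡ = bit-cons-zero (y + 2 ^ c) (bit<2 x 0)
    others (suc j) j≢c rewrite x+≡ =
      trans (bit-cons-suc _ j (bit<2 x 0)) (proj₂ (set-bit c y x_c≡0) j (j≢c ∘ cong suc))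

  clear-bit : ∀ c x → bit x c ≡ 1 →
    Σ ℕ λ x′ → x ≡ x′ + 2 ^ c × bit x′ c ≡ 0 × (∀ j → j ≢ c → bit x′ j ≡ bit x j)
  clear-bit zero x x₀≡1 = (x / 2) * 2 , x≡ , bit-cons-zero (x / 2) z<s , others
    where
    x≡ : x ≡ (x / 2) * 2 + 2 ^ 0
    x≡ = trans (bit-decomposition x) (trans (cong (_+ (x / 2) * 2) x₀≡1) (+-comm 1 _))
    others : ∀ j → j ≢ 0 → bit ((x / 2) * 2) j ≡ bit x j
    others zero j≢0 = contradiction refl j≢0
    others (suc j) _ = bit-cons-suc (x / 2) j z<s
  clear-bit (suc c) x x_c≡1 with clear-bit c (x / 2) x_c≡1
  ... | y′ , y≡ , y′_c≡0 , others′ =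
    b + y′ * 2 , x≡ , trans (bit-cons-suc y′ c (bit<2 x 0)) y′_c≡0 , others
    where
    b : ℕ
    b = bit x 0
    x≡ : x ≡ (b + y′ * 2) + 2 ^ suc c
    x≡ = begin
      x                        ≡⟨ bit-decomposition x ⟩
      b + (x / 2) * 2          ≡⟨ cong (λ z → b + z * 2) y≡ ⟩
      b + (y′ + 2 ^ c) * 2     ≡⟨ cong (b +_) (*-distribʳ-+ 2 y′ (2 ^ c)) ⟩
      b + (y′ * 2 + 2 ^ c * 2) ≡⟨ cong (λ z → b + (y′ * 2 + z)) (*-comm (2 ^ c) 2) ⟩
      b + (y′ * 2 + 2 ^ suc c) ≡⟨ +-assoc b _ _ ⟨
      b + y′ * 2 + 2 ^ suc c   ∎
      where open ≡-Reasoning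
    others : ∀ j → j ≢ suc c → bit (b + y′ * 2) j ≡ bit x j
    others zero _ = bit-cons-zero y′ (bit<2 x 0)
    others (suc j) j≢c = trans (bit-cons-suc y′ j (bit<2 x 0)) (others′ j λ j≡c → j≢c (cong suc j≡c))

  set-bit-< : ∀ n c x → x < 2 ^ n → c < n → bit x c ≡ 0 → x + 2 ^ c < 2 ^ n
  set-bit-< (suc n) zero x x< _ x₀≡0 = begin-strict
    x + 1               ≡⟨ cong (_+ 1) (trans (bit-decomposition x) (cong (_+ (x / 2) * 2) x₀≡0)) ⟩
    (x / 2) * 2 + 1     <⟨ +-monoʳ-< ((x / 2) * 2) (s≤s (s≤s z≤n)) ⟩
    (x / 2) * 2 + 2 * 1 ≡⟨ cong (_+ 2 * 1) (*-comm (x / 2) 2) ⟩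
    2 * (x / 2) + 2 * 1 ≡⟨ *-distribˡ-+ 2 (x / 2) 1 ⟨
    2 * (x / 2 + 1)     ≤⟨ *-monoʳ-≤ 2 (subst (_≤ 2 ^ n) (+-comm 1 (x / 2)) (half< n x x<)) ⟩
    2 ^ suc n           ∎
    where open ≤-Reasoning
  set-bit-< (suc n) (suc c) x x< (s≤s c<n) x_c≡0 = begin-strict
    x + 2 ^ suc c           ≡⟨ cong (_+ 2 ^ suc c) (bit-decomposition x) ⟩
    b + y * 2 + 2 * 2 ^ c   ≡⟨ +-assoc b _ _ ⟩
    b + (y * 2 + 2 * 2 ^ c) ≡⟨ cong (λ z → b + (z + 2 * 2 ^ c)) (*-comm y 2) ⟩
    b + (2 * y + 2 * 2 ^ c) ≡⟨ cong (b +_) (*-distribˡ-+ 2 y (2 ^ c)) ⟨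
    b + 2 * (y + 2 ^ c)     <⟨ +-monoˡ-< (2 * (y + 2 ^ c)) (bit<2 x 0) ⟩
    2 * 1 + 2 * (y + 2 ^ c) ≡⟨ *-distribˡ-+ 2 1 (y + 2 ^ c) ⟨
    2 * suc (y + 2 ^ c)     ≤⟨ *-monoʳ-≤ 2 (set-bit-< n c y (half< n x x<) c<n x_c≡0) ⟩
    2 ^ suc n               ∎
    where
    open ≤-Reasoning
    y b : ℕ
    y = x / 2
    b = bit x 0

  -- flipCoord counts coordinates from 1; toggle counts bits from 0
  toggle : ℕ → ℕ → ℕ
  toggle x c = flipCoord x (suc c)

  toggle-bits : ∀ x c →
    bit (toggle x c) c ≡ 1 ∸ bit x c × (∀ j → j ≢ c → bit (toggle x c) j ≡ bit x j)
  toggle-bits x c with bit x c in x_c | bit<2 x c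
  ... | 0 | _ = set-bit c x x_c
  ... | 1 | _ with clear-bit c x x_c
  ...   | x′ , x≡ , x′_c≡0 , others =
    trans (cong (λ z → bit z c) x∸≡) x′_c≡0 ,
    λ j j≢c → trans (cong (λ z → bit z j) x∸≡) (others j j≢c)
    where
    x∸≡ : x ∸ 2 ^ c ≡ x′
    x∸≡ = trans (cong (_∸ 2 ^ c) x≡) (m+n∸n≡m x′ (2 ^ c))
  toggle-bits x c | suc (suc _) | s≤s (s≤s ())

  toggle-involutive : ∀ x c → toggle (toggle x c) c ≡ x
  toggle-involutive x c with bit x c in x_c | bit<2 x c
  ... | 0 | _ with bit (x + 2 ^ c) c | proj₁ (set-bit c x x_c)
  ...   | .1 | refl = m+n∸n≡m x (2 ^ c)
  toggle-involutive x c | 1 | _ with clear-bit c x x_c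
  ...   | x′ , refl , x′_c≡0 , _ rewrite m+n∸n≡m x′ (2 ^ c) | x′_c≡0 = refl
  toggle-involutive x c | suc (suc _) | s≤s (s≤s ())

  toggle-swap : ∀ {x y} c → x ≡ toggle y c → y ≡ toggle x c
  toggle-swap {x} {y} c x≡ = trans (sym (toggle-involutive y c)) (cong (λ z → toggle z c) (sym x≡))

  toggle-< : ∀ n x c → x < 2 ^ n → c < n → toggle x c < 2 ^ n
  toggle-< n x c x< c<n with bit x c in x_c | bit<2 x c
  ... | 0 | _ = set-bit-< n c x x< c<n x_c
  ... | 1 | _ = ≤-<-trans (m∸n≤m x (2 ^ c)) x<
  ... | suc (suc _) | s≤s (s≤s ())

  toggle-≢ : ∀ x c → toggle x c ≢ x
  toggle-≢ x c eq =
    no-fixpoint (bit x c) (bit<2 x c) (trans (cong (λ z → bit z c) (sym eq)) (proj₁ (toggle-bits x c)))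
    where
    no-fixpoint : ∀ b → b < 2 → b ≢ 1 ∸ b
    no-fixpoint 0 _ ()
    no-fixpoint 1 _ ()

  bits-2^n+ : ∀ n x → x < 2 ^ n → bit (2 ^ n + x) n ≡ 1 × (∀ j → j ≢ n → bit (2 ^ n + x) j ≡ bit x j)
  bits-2^n+ n x x< rewrite +-comm (2 ^ n) x = set-bit n x (bit-≥-width n x n x< ≤-refl)

module Neighbours where

  open Bits
  open import Data.Nat using (ℕ; zero; suc; _<_; _^_; _≟_; _<?_; _≡ᵇ_; _<ᵇ_; s≤s; s<s; z<s; s≤s⁻¹)
  open import Data.Nat.Properties using (suc-injective; <-irrefl; n<1+n; ≤-trans; <-trans; m<n⇒m<1+n)
  open import Data.Bool using (Bool; true; false; if_then_else_; _∨_)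
  open import Data.Bool.Properties using (∨-identityʳ; ∨-zeroʳ)
  open import Data.Fin using (Fin; toℕ)
  open import Data.Fin.Properties using (toℕ<n)
  open import Data.Product using (_,_; proj₁; proj₂)
  open import Function using (_∘_)
  open import Relation.Nullary using (yes; no; contradiction)
  open import Relation.Nullary.Decidable using (dec-true; dec-false)
  open import Relation.Binary.PropositionalEquality as ≡ using (_≡_; _≢_)

  adj : ℕ → ℕ → ℕ → ℕ → Bool
  adj a l x j = edgeUp a l x j ∨ edgeUp x j a l

  n≢2+n : ∀ n → n ≢ suc (suc n)
  n≢2+n n eq = <-irrefl eq (m<n⇒m<1+n (n<1+n n))

  adj-down : ∀ a l x → adj a l x (suc l) ≡ (x ≡ᵇ a) ∨ (x ≡ᵇ toggle a l)
  adj-down a l x rewrite dec-true (l ≟ l) ≡.refl | dec-false (l ≟ suc (suc l)) (n≢2+n l) = ∨-identityʳ _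

  adj-up : ∀ a j x → adj a (suc j) x j ≡ (a ≡ᵇ x) ∨ (a ≡ᵇ toggle x j)
  adj-up a j x rewrite dec-false (j ≟ suc (suc j)) (n≢2+n j) | dec-true (j ≟ j) ≡.refl = ≡.refl

  adj-far : ∀ a l x j → j ≢ suc l → l ≢ suc j → adj a l x j ≡ false
  adj-far a l x j j≢1+l l≢1+j rewrite dec-false (j ≟ suc l) j≢1+l | dec-false (l ≟ suc j) l≢1+j = ≡.refl

  module Weighted {c ℓ} (F : Field c ℓ) where
    open Field F hiding (zero)
    open import Relation.Binary.Reasoning.Setoid setoid
    open LinearAlgebra F using (sum; ∑²; ∑-comm)

    ∑ℕ : ℕ → (ℕ → Carrier) → Carrier
    ∑ℕ n G = sum {n} (G ∘ toℕ)

    ∑ℕ-zero : ∀ n G → (∀ m → m < n → G m ≈ 0#) → ∑ℕ n G ≈ 0#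
    ∑ℕ-zero zero G G≈0 = refl
    ∑ℕ-zero (suc n) G G≈0 =
      trans (+-cong (G≈0 0 z<s) (∑ℕ-zero n (G ∘ suc) λ m m<n → G≈0 (suc m) (s<s m<n))) (+-identityʳ 0#)

    ∑ℕ-single : ∀ n G m₁ → m₁ < n → (∀ m → m < n → m ≢ m₁ → G m ≈ 0#) → ∑ℕ n G ≈ G m₁
    ∑ℕ-single (suc n) G zero _ G≈0 =
      trans (+-congˡ (∑ℕ-zero n (G ∘ suc) λ m m<n → G≈0 (suc m) (s<s m<n) λ ())) (+-identityʳ _)
    ∑ℕ-single (suc n) G (suc m₁) (s≤s m₁<n) G≈0 =
      trans (+-cong (G≈0 0 z<s λ ())
                    (∑ℕ-single n (G ∘ suc) m₁ m₁<n λ m m<n m≢m₁ → G≈0 (suc m) (s<s m<n) (m≢m₁ ∘ suc-injective)))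
            (+-identityˡ _)

    ∑ℕ-pair : ∀ n G m₁ m₂ → m₁ ≢ m₂ → m₁ < n → m₂ < n →
      (∀ m → m < n → m ≢ m₁ → m ≢ m₂ → G m ≈ 0#) → ∑ℕ n G ≈ G m₁ + G m₂
    ∑ℕ-pair (suc n) G zero zero m₁≢m₂ _ _ _ = contradiction ≡.refl m₁≢m₂
    ∑ℕ-pair (suc n) G zero (suc m₂) _ _ (s≤s m₂<n) G≈0 =
      +-congˡ (∑ℕ-single n (G ∘ suc) m₂ m₂<n λ m m<n m≢m₂ → G≈0 (suc m) (s<s m<n) (λ ()) (m≢m₂ ∘ suc-injective))
    ∑ℕ-pair (suc n) G (suc m₁) zero _ (s≤s m₁<n) _ G≈0 =
      trans (+-congˡ (∑ℕ-single n (G ∘ suc) m₁ m₁<n λ m m<n m≢m₁ →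
                        G≈0 (suc m) (s<s m<n) (m≢m₁ ∘ suc-injective) (λ ())))
            (+-comm _ _)
    ∑ℕ-pair (suc n) G (suc m₁) (suc m₂) m₁≢m₂ (s≤s m₁<n) (s≤s m₂<n) G≈0 =
      trans (+-cong (G≈0 0 z<s (λ ()) (λ ()))
                    (∑ℕ-pair n (G ∘ suc) m₁ m₂ (m₁≢m₂ ∘ ≡.cong suc) m₁<n m₂<n
                       λ m m<n m≢m₁ m≢m₂ → G≈0 (suc m) (s<s m<n) (m≢m₁ ∘ suc-injective) (m≢m₂ ∘ suc-injective)))
            (+-identityˡ _)

    weight : Bool → Carrier
    weight b = if b then 1# else 0#

    *-weight-true : ∀ {b} y → b ≡ true → y * weight b ≈ y
    *-weight-true y ≡.refl = *-identityʳ y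

    *-weight-false : ∀ {b} y → b ≡ false → y * weight b ≈ 0#
    *-weight-false y ≡.refl = zeroʳ y

    ∑ℕ-weight-pair : ∀ n (G : ℕ → Carrier) (t : ℕ → Bool) {m₁ m₂} → m₁ ≢ m₂ → m₁ < n → m₂ < n →
      t m₁ ≡ true → t m₂ ≡ true → (∀ m → m ≢ m₁ → m ≢ m₂ → t m ≡ false) →
      ∑ℕ n (λ m → G m * weight (t m)) ≈ G m₁ + G m₂
    ∑ℕ-weight-pair n G t {m₁} {m₂} m₁≢m₂ m₁<n m₂<n t₁ t₂ t-off =
      trans (∑ℕ-pair n _ m₁ m₂ m₁≢m₂ m₁<n m₂<n λ m _ m≢m₁ m≢m₂ →
               *-weight-false (G m) (t-off m m≢m₁ m≢m₂))
            (+-cong (*-weight-true (G m₁) t₁) (*-weight-true (G m₂) t₂))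

    lowerPair : (ℕ → ℕ → Carrier) → ℕ → ℕ → Carrier
    lowerPair Y x l = Y x l + Y (toggle x l) l

    upperPair : (ℕ → ℕ → Carrier) → ℕ → ℕ → Carrier
    upperPair Y x j = Y x (suc j) + Y (toggle x j) (suc j)

    -- (x , j) is adjacent to (x , j - 1) and (toggle x (j - 1) , j - 1) if 0 < j,
    -- and to (x , j + 1) and (toggle x j , j + 1) if j < r
    neighbourSum : ℕ → (ℕ → ℕ → Carrier) → ℕ → ℕ → Carrier
    neighbourSum r Y x j = lower j + (if j <ᵇ r then upperPair Y x j else 0#)
      where
      lower : ℕ → Carrier
      lower zero = 0#
      lower (suc l) = lowerPair Y x l

    module _ (r : ℕ) (Y : ℕ → ℕ → Carrier) (x : ℕ) (x< : x < 2 ^ r) where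

      levelSum : ℕ → ℕ → Carrier
      levelSum j l = ∑ℕ (2 ^ r) (λ a → Y a l * weight (adj a l x j))

      levelSum-below : ∀ l → l < r → levelSum (suc l) l ≈ lowerPair Y x l
      levelSum-below l l<r =
        ∑ℕ-weight-pair (2 ^ r) (λ a → Y a l) (λ a → adj a l x (suc l))
          (toggle-≢ x l ∘ ≡.sym) x< (toggle-< r x l x< l<r) at-x at-toggle off
        where
        at-x : adj x l x (suc l) ≡ true
        at-x rewrite adj-down x l x | dec-true (x ≟ x) ≡.refl = ≡.refl
        at-toggle : adj (toggle x l) l x (suc l) ≡ true
        at-toggle rewrite adj-down (toggle x l) l x | toggle-involutive x l | dec-true (x ≟ x) ≡.refl = ∨-zeroʳ _
        off : ∀ a → a ≢ x → a ≢ toggle x l → adj a l x (suc l) ≡ false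
        off a a≢x a≢x′ rewrite adj-down a l x | dec-false (x ≟ a) (a≢x ∘ ≡.sym)
                             | dec-false (x ≟ toggle a l) (a≢x′ ∘ toggle-swap l) = ≡.refl

      levelSum-above : ∀ j → j < r → levelSum j (suc j) ≈ upperPair Y x j
      levelSum-above j j<r =
        ∑ℕ-weight-pair (2 ^ r) (λ a → Y a (suc j)) (λ a → adj a (suc j) x j)
          (toggle-≢ x j ∘ ≡.sym) x< (toggle-< r x j x< j<r) at-x at-toggle off
        where
        at-x : adj x (suc j) x j ≡ true
        at-x rewrite adj-up x j x | dec-true (x ≟ x) ≡.refl = ≡.refl
        at-toggle : adj (toggle x j) (suc j) x j ≡ true
        at-toggle rewrite adj-up (toggle x j) j x | dec-true (toggle x j ≟ toggle x j) ≡.refl = ∨-zeroʳ _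
        off : ∀ a → a ≢ x → a ≢ toggle x j → adj a (suc j) x j ≡ false
        off a a≢x a≢x′ rewrite adj-up a j x | dec-false (a ≟ x) a≢x
                             | dec-false (a ≟ toggle x j) a≢x′ = ≡.refl

      levelSum-far : ∀ j l → j ≢ suc l → l ≢ suc j → levelSum j l ≈ 0#
      levelSum-far j l j≢1+l l≢1+j = ∑ℕ-zero (2 ^ r) (λ a → Y a l * weight (adj a l x j)) λ a _ →
        *-weight-false _ (adj-far a l x j j≢1+l l≢1+j)

      levelSums≈neighbourSum : ∀ j → j Data.Nat.≤ r → ∑ℕ (suc r) (levelSum j) ≈ neighbourSum r Y x j
      levelSums≈neighbourSum zero _ with 0 <? r
      ... | yes 0<r rewrite dec-true (0 <? r) 0<r = begin
        ∑ℕ (suc r) (levelSum 0) ≈⟨ ∑ℕ-single (suc r) (levelSum 0) 1 (s<s 0<r) (λ l _ → levelSum-far 0 l λ ()) ⟩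
        levelSum 0 1            ≈⟨ levelSum-above 0 0<r ⟩
        upperPair Y x 0         ≈⟨ +-identityˡ _ ⟨
        0# + upperPair Y x 0    ∎
      ... | no 0≮r rewrite dec-false (0 <? r) 0≮r =
        trans (∑ℕ-zero (suc r) (levelSum 0) λ l l<1+r →
                 levelSum-far 0 l (λ ()) λ l≡1 → 0≮r (s≤s⁻¹ (≡.subst (_< suc r) l≡1 l<1+r)))
              (sym (+-identityʳ 0#))
      levelSums≈neighbourSum (suc l) 1+l≤r with suc l <? r
      ... | yes 1+l<r rewrite dec-true (suc l <? r) 1+l<r =
        trans (∑ℕ-pair (suc r) (levelSum (suc l)) l (suc (suc l)) (n≢2+n l)
                 (m<n⇒m<1+n (≤-trans (n<1+n l) 1+l≤r)) (s<s 1+l<r)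
                 λ l′ _ l′≢l → levelSum-far (suc l) l′ (l′≢l ∘ ≡.sym ∘ suc-injective))
              (+-cong (levelSum-below l (<-trans (n<1+n l) 1+l<r)) (levelSum-above (suc l) 1+l<r))
      ... | no 1+l≮r rewrite dec-false (suc l <? r) 1+l≮r =
        trans (∑ℕ-single (suc r) (levelSum (suc l)) l (m<n⇒m<1+n (≤-trans (n<1+n l) 1+l≤r))
                 λ l′ l′<1+r l′≢l → levelSum-far (suc l) l′ (l′≢l ∘ ≡.sym ∘ suc-injective)
                   λ l′≡2+l → 1+l≮r (s≤s⁻¹ (≡.subst (_< suc r) l′≡2+l l′<1+r)))
              (trans (levelSum-below l 1+l≤r) (sym (+-identityʳ _)))

    left-multiply : ∀ r (Y : ℕ → ℕ → Carrier) (w : Vertex r) →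
      ∑² (λ q → Y (toℕ (proj₁ q)) (toℕ (proj₂ q)) * adjMatrix F r q w)
        ≈ neighbourSum r Y (toℕ (proj₁ w)) (toℕ (proj₂ w))
    left-multiply r Y (x , j) =
      trans (∑-comm {2 ^ r} {suc r} (λ a l → Y (toℕ a) (toℕ l) * weight (adj (toℕ a) (toℕ l) (toℕ x) (toℕ j))))
            (levelSums≈neighbourSum r Y (toℕ x) (toℕ<n x) (toℕ j) (s≤s⁻¹ (toℕ<n j)))

module DigitProducts {c ℓ} (F : Field c ℓ) where

  open Bits
  open import Data.Nat using (ℕ; zero; suc; _<_; _≟_; _≡ᵇ_; s≤s⁻¹)
  open import Data.Nat.Properties using (n<1+n; m<n⇒m<1+n; <⇒≢; ≤∧≢⇒<)
  open import Data.Bool using (if_then_else_)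
  open import Data.Product using (proj₁; proj₂)
  open import Data.Sum using (_⊎_; inj₁; inj₂)
  open import Relation.Nullary using (yes; no)
  open import Function using (_∘_)
  open import Relation.Nullary.Decidable using (dec-true; dec-false)
  open import Relation.Binary.PropositionalEquality as ≡ using (_≡_; _≢_)

  open Field F hiding (zero)
  open import Relation.Binary.Reasoning.Setoid setoid

  ∏bits : ℕ → (ℕ → ℕ → Carrier) → ℕ → Carrier
  ∏bits zero g x = 1#
  ∏bits (suc n) g x = ∏bits n g x * g n (bit x n)

  ∏bits-cong-bits : ∀ n g x x′ → (∀ b → b < n → bit x′ b ≡ bit x b) → ∏bits n g x′ ≡ ∏bits n g x
  ∏bits-cong-bits zero g x x′ _ = ≡.refl
  ∏bits-cong-bits (suc n) g x x′ same =
    ≡.cong₂ _*_ (∏bits-cong-bits n g x x′ λ b b<n → same b (m<n⇒m<1+n b<n)) (≡.cong (g n) (same n (n<1+n n)))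

  ∏bits-cong : ∀ n g h x → (∀ b → b < n → ∀ v → g b v ≈ h b v) → ∏bits n g x ≈ ∏bits n h x
  ∏bits-cong zero g h x _ = refl
  ∏bits-cong (suc n) g h x g≈h =
    *-cong (∏bits-cong n g h x λ b b<n → g≈h b (m<n⇒m<1+n b<n)) (g≈h n (n<1+n n) _)

  ∏bits-one : ∀ n g x → (∀ b → b < n → g b (bit x b) ≈ 1#) → ∏bits n g x ≈ 1#
  ∏bits-one zero g x _ = refl
  ∏bits-one (suc n) g x g≈1 =
    trans (*-cong (∏bits-one n g x λ b b<n → g≈1 b (m<n⇒m<1+n b<n)) (g≈1 n (n<1+n n))) (*-identityˡ 1#)

  ∏bits-zero-or : ∀ n g x (Q : ℕ → Set) → (∀ b → b < n → g b (bit x b) ≈ 0# ⊎ Q b) →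
    ∏bits n g x ≈ 0# ⊎ (∀ b → b < n → Q b)
  ∏bits-zero-or zero g x Q _ = inj₂ λ b ()
  ∏bits-zero-or (suc n) g x Q zero-or
    with ∏bits-zero-or n g x Q (λ b b<n → zero-or b (m<n⇒m<1+n b<n)) | zero-or n (n<1+n n)
  ... | inj₁ ∏≈0 | _ = inj₁ (trans (*-congʳ ∏≈0) (zeroˡ _))
  ... | inj₂ _ | inj₁ g≈0 = inj₁ (trans (*-congˡ g≈0) (zeroʳ _))
  ... | inj₂ Q<n | inj₂ Qn = inj₂ λ b b<1+n → case b b<1+n
    where
    case : ∀ b → b < suc n → Q b
    case b b<1+n with b ≟ n
    ... | yes ≡.refl = Qn
    ... | no b≢n = Q<n b (≤∧≢⇒< (s≤s⁻¹ b<1+n) b≢n)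

  dropFactor : ℕ → (ℕ → ℕ → Carrier) → ℕ → ℕ → Carrier
  dropFactor c g b v = if b ≡ᵇ c then 1# else g b v

  dropFactor-at : ∀ c g v → dropFactor c g c v ≡ 1#
  dropFactor-at c g v rewrite dec-true (c ≟ c) ≡.refl = ≡.refl

  dropFactor-other : ∀ c g b v → b ≢ c → dropFactor c g b v ≡ g b v
  dropFactor-other c g b v b≢c rewrite dec-false (b ≟ c) b≢c = ≡.refl

  ∏bits-toggle : ∀ n g x c → c < n →
    ∏bits n g x + ∏bits n g (toggle x c) ≈ (g c 0 + g c 1) * ∏bits n (dropFactor c g) x
  ∏bits-toggle (suc n) g x c c<1+n with c ≟ n
  ... | yes ≡.refl = begin
    ∏bits c g x * g c (bit x c) + ∏bits c g (toggle x c) * g c (bit (toggle x c) c)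
      ≈⟨ +-congˡ (*-congʳ (reflexive (∏bits-cong-bits c g x (toggle x c) λ b b<c →
                                         proj₂ (toggle-bits x c) b (<⇒≢ b<c)))) ⟩
    ∏bits c g x * g c (bit x c) + ∏bits c g x * g c (bit (toggle x c) c)
      ≈⟨ distribˡ _ _ _ ⟨
    ∏bits c g x * (g c (bit x c) + g c (bit (toggle x c) c))
      ≈⟨ *-congˡ both-digits ⟩
    ∏bits c g x * (g c 0 + g c 1)
      ≈⟨ *-comm _ _ ⟩
    (g c 0 + g c 1) * ∏bits c g x
      ≈⟨ *-congˡ (∏bits-cong c _ _ x λ b b<c v → reflexive (dropFactor-other c g b v (<⇒≢ b<c))) ⟨
    (g c 0 + g c 1) * ∏bits c (dropFactor c g) x
      ≈⟨ *-congˡ (trans (*-congˡ (reflexive (dropFactor-at c g (bit x c)))) (*-identityʳ _)) ⟨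
    (g c 0 + g c 1) * ∏bits (suc c) (dropFactor c g) x ∎
    where
    both-digits : g c (bit x c) + g c (bit (toggle x c) c) ≈ g c 0 + g c 1
    both-digits rewrite proj₁ (toggle-bits x c) with bit x c | bit<2 x c
    ... | 0 | _ = refl
    ... | 1 | _ = +-comm _ _
    ... | suc (suc _) | Data.Nat.s≤s (Data.Nat.s≤s ())
  ... | no c≢n = begin
    ∏bits n g x * g n (bit x n) + ∏bits n g (toggle x c) * g n (bit (toggle x c) n)
      ≈⟨ +-congˡ (*-congˡ (reflexive (≡.cong (g n) (proj₂ (toggle-bits x c) n (c≢n ∘ ≡.sym))))) ⟩
    ∏bits n g x * g n (bit x n) + ∏bits n g (toggle x c) * g n (bit x n)
      ≈⟨ distribʳ _ _ _ ⟨
    (∏bits n g x + ∏bits n g (toggle x c)) * g n (bit x n)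
      ≈⟨ *-congʳ (∏bits-toggle n g x c (≤∧≢⇒< (s≤s⁻¹ c<1+n) c≢n)) ⟩
    ((g c 0 + g c 1) * ∏bits n (dropFactor c g) x) * g n (bit x n)
      ≈⟨ *-assoc _ _ _ ⟩
    (g c 0 + g c 1) * (∏bits n (dropFactor c g) x * g n (bit x n))
      ≈⟨ *-congˡ (*-congˡ (reflexive (dropFactor-other c g n _ (c≢n ∘ ≡.sym)))) ⟨
    (g c 0 + g c 1) * ∏bits (suc n) (dropFactor c g) x ∎

module Chain where

  open Bits
  open import Data.Nat using (ℕ; zero; suc; _<_; _≤_; _∸_; _≟_; _<?_; _≤?_; _≡ᵇ_; _<ᵇ_; _≤ᵇ_; s≤s; s<s; s≤s⁻¹)
  open import Data.Nat.Properties
    using (<⇒≢; <-irrefl; <-asym; ≤-refl; ≤-trans; <-trans; n≤1+n; n<1+n; m<n⇒m<1+n; ≤∧≢⇒<; m+n∸n≡m)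
  open import Data.Bool using (Bool; true; false; not; if_then_else_; _∧_; _∨_; _xor_)
  open import Data.Bool.Properties using (not-involutive; ∨-zeroʳ; ∧-zeroʳ)
  open import Data.Product using (_×_; _,_; proj₁; proj₂)
  open import Function using (_∘_)
  open import Data.Sum using (_⊎_; inj₁; inj₂)
  open import Relation.Nullary using (¬_; yes; no; contradiction)
  open import Relation.Nullary.Decidable using (dec-true; dec-false; does-⇔; _×-dec_)
  open import Function.Bundles using (mk⇔)
  open import Relation.Binary.PropositionalEquality as ≡ using (_≡_; _≢_)

  even : ℕ → Bool
  even zero = true
  even (suc n) = not (even n)

  even-2+ : ∀ n → even (suc (suc n)) ≡ even n
  even-2+ n = not-involutive (even n)

  ∸≡suc[∸suc] : ∀ {m n} → m < n → n ∸ m ≡ suc (n ∸ suc m)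
  ∸≡suc[∸suc] {zero} {suc n} _ = ≡.refl
  ∸≡suc[∸suc] {suc m} {suc n} (s<s m<n) = ∸≡suc[∸suc] m<n

  even-∸ : ∀ {m n} → m < n → even (n ∸ m) ≡ not (even (n ∸ suc m))
  even-∸ m<n = ≡.cong even (∸≡suc[∸suc] m<n)

  ∸≡2+∸ : ∀ {m n} → suc (suc m) ≤ n → n ∸ m ≡ suc (suc (n ∸ suc (suc m)))
  ∸≡2+∸ 2+m≤n = ≡.trans (∸≡suc[∸suc] (≤-trans (n≤1+n _) 2+m≤n)) (≡.cong suc (∸≡suc[∸suc] 2+m≤n))

  <ᵇ-skip2 : ∀ {b j} → b ≢ j → b ≢ suc j → (b <ᵇ j) ≡ (b <ᵇ suc (suc j))
  <ᵇ-skip2 {b} {j} b≢j b≢1+j = does-⇔ (mk⇔ (λ b<j → <-trans b<j (<-trans (n<1+n j) (n<1+n (suc j))))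
    (λ b<2+j → ≤∧≢⇒< (s≤s⁻¹ (≤∧≢⇒< (s≤s⁻¹ b<2+j) b≢1+j)) b≢j)) (b <? j) (b <? suc (suc j))

  even-∸-next : ∀ {m n} → m < n → even (n ∸ m) ≡ true → even (n ∸ suc m) ≡ false
  even-∸-next m<n ev = ≡.trans (≡.sym (not-involutive _)) (≡.cong not (≡.trans (≡.sym (even-∸ m<n)) ev))

  data Factor : Set where
    signed constant atZero frozen : Factor

  -- The factor at bit b, on level m, of the vector of a chain from level i up to level ℓ.
  -- It is signed (its two values cancel) at the ends b = i - 1 and b = ℓ < r of the chain,
  -- alternately constant and zero-only along the chain, and frozen at the pivot's digit
  -- elsewhere.
  chainKind : (r ℓ i b : ℕ) → Bool → Factor
  chainKind r ℓ i b below =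
    if (suc b ≡ᵇ i) ∨ ((b ≡ᵇ ℓ) ∧ (ℓ <ᵇ r)) then signed
    else if (i ≤ᵇ b) ∧ (b <ᵇ ℓ) then (if even (ℓ ∸ b) xor below then atZero else constant)
    else frozen

  factorKind : (r ℓ i b m : ℕ) → Factor
  factorKind r ℓ i b m = chainKind r ℓ i b (b <ᵇ m)

  module Kinds (r ℓ i : ℕ) where

    kind-bottom : ∀ {b} m → suc b ≡ i → factorKind r ℓ i b m ≡ signed
    kind-bottom {b} m 1+b≡i rewrite dec-true (suc b ≟ i) 1+b≡i = ≡.refl

    kind-top : ∀ m → ℓ < r → factorKind r ℓ i ℓ m ≡ signed
    kind-top m ℓ<r rewrite dec-true (ℓ ≟ ℓ) ≡.refl | dec-true (ℓ <? r) ℓ<r | ∨-zeroʳ (suc ℓ ≡ᵇ i) =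
      ≡.refl

    private
      top-test-false : ∀ {b} → b ≢ ℓ ⊎ ¬ ℓ < r → ((b ≡ᵇ ℓ) ∧ (ℓ <ᵇ r)) ≡ false
      top-test-false {b} (inj₁ b≢ℓ) rewrite dec-false (b ≟ ℓ) b≢ℓ = ≡.refl
      top-test-false {b} (inj₂ ℓ≮r) rewrite dec-false (ℓ <? r) ℓ≮r = ∧-zeroʳ _

      chain-test-false : ∀ {b} → ¬ (i ≤ b × b < ℓ) → ((i ≤ᵇ b) ∧ (b <ᵇ ℓ)) ≡ false
      chain-test-false {b} not-chain with i ≤? b
      ... | no i≰b rewrite dec-false (i ≤? b) i≰b = ≡.refl
      ... | yes i≤b rewrite dec-true (i ≤? b) i≤b | dec-false (b <? ℓ) (λ b<ℓ → not-chain (i≤b , b<ℓ)) =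
        ≡.refl

    kind-outside : ∀ {b} m → suc b ≢ i → (b ≢ ℓ ⊎ ¬ ℓ < r) → ¬ (i ≤ b × b < ℓ) →
      factorKind r ℓ i b m ≡ frozen
    kind-outside {b} m 1+b≢i not-top not-chain
      rewrite dec-false (suc b ≟ i) 1+b≢i | top-test-false not-top | chain-test-false not-chain = ≡.refl

    kind-chain : ∀ {b} m {e t} → i ≤ b → b < ℓ → even (ℓ ∸ b) ≡ e → (b <ᵇ m) ≡ t →
      factorKind r ℓ i b m ≡ (if e xor t then atZero else constant)
    kind-chain {b} m i≤b b<ℓ ≡.refl ≡.refl
      rewrite dec-false (suc b ≟ i) (λ 1+b≡i → <-irrefl (≡.sym 1+b≡i) (s≤s i≤b))
            | dec-false (b ≟ ℓ) (<⇒≢ b<ℓ) | dec-true (i ≤? b) i≤b | dec-true (b <? ℓ) b<ℓ = ≡.refl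

    kind-level : ∀ b m m′ → (b <ᵇ m) ≡ (b <ᵇ m′) → factorKind r ℓ i b m ≡ factorKind r ℓ i b m′
    kind-level b m m′ = ≡.cong (chainKind r ℓ i b)

  module ChainVector {c ℓ′} (F : Field c ℓ′) where

    open Field F hiding (zero)
    open import Algebra.Properties.Group +-group using (ε⁻¹≈ε)
    open import Algebra.Properties.Ring ring using (-‿distribˡ-*)
    open import Relation.Binary.Reasoning.Setoid setoid
    open DigitProducts F
    open Neighbours using (module Weighted)
    open Weighted F using (lowerPair; upperPair; neighbourSum)

    factorValue : Factor → ℕ → ℕ → Carrier
    factorValue signed v _ = if v ≡ᵇ 1 then 1# else - 1#
    factorValue constant _ _ = 1#
    factorValue atZero v _ = if v ≡ᵇ 0 then 1# else 0#
    factorValue frozen v xb = if v ≡ᵇ xb then 1# else 0#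

    chainSign : ℕ → Carrier
    chainSign zero = 1#
    chainSign (suc zero) = 0#
    chainSign (suc (suc n)) = - chainSign n

    chainSign-odd : ∀ n → even n ≡ false → chainSign n ≈ 0#
    chainSign-odd (suc zero) _ = refl
    chainSign-odd (suc (suc n)) odd =
      trans (-‿cong (chainSign-odd n (≡.trans (≡.sym (even-2+ n)) odd))) ε⁻¹≈ε

    digitSum-signed : ∀ {K} xb → K ≡ signed → factorValue K 0 xb + factorValue K 1 xb ≈ 0#
    digitSum-signed _ ≡.refl = -‿inverseˡ 1#

    digitSum-atZero : ∀ {K} xb → K ≡ atZero → factorValue K 0 xb + factorValue K 1 xb ≈ 1#
    digitSum-atZero _ ≡.refl = +-identityʳ 1#

    module _ (r ℓ i x : ℕ) where

      open Kinds r ℓ i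

      factor : ℕ → ℕ → ℕ → Carrier
      factor m b v = factorValue (factorKind r ℓ i b m) v (bit x b)

      levelCoeff : ℕ → Carrier
      levelCoeff m = if (i ≤ᵇ m) ∧ (m ≤ᵇ ℓ) then chainSign (ℓ ∸ m) else 0#

      -- The left-kernel vector attached to a pivot (x , ℓ) whose chain ends at level i:
      -- on the levels ℓ, ℓ - 2, …, i it is ±1 times a product of one factor per bit.
      chainVector : ℕ → ℕ → Carrier
      chainVector x′ m = levelCoeff m * ∏bits r (factor m) x′

      levelCoeff-cases : ∀ m →
        (i ≤ m × m ≤ ℓ × levelCoeff m ≡ chainSign (ℓ ∸ m)) ⊎ levelCoeff m ≡ 0#
      levelCoeff-cases m with i ≤? m | m ≤? ℓ
      ... | yes i≤m | yes m≤ℓ rewrite dec-true (i ≤? m) i≤m | dec-true (m ≤? ℓ) m≤ℓ =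
        inj₁ (i≤m , m≤ℓ , ≡.refl)
      ... | no i≰m | _ rewrite dec-false (i ≤? m) i≰m = inj₂ ≡.refl
      ... | yes i≤m | no m≰ℓ rewrite dec-true (i ≤? m) i≤m | dec-false (m ≤? ℓ) m≰ℓ = inj₂ ≡.refl

      levelCoeff-in : ∀ {m} → i ≤ m → m ≤ ℓ → levelCoeff m ≡ chainSign (ℓ ∸ m)
      levelCoeff-in {m} i≤m m≤ℓ rewrite dec-true (i ≤? m) i≤m | dec-true (m ≤? ℓ) m≤ℓ = ≡.refl

      levelCoeff-out : ∀ {m} → ¬ (i ≤ m × m ≤ ℓ) → levelCoeff m ≈ 0#
      levelCoeff-out {m} out with levelCoeff-cases m
      ... | inj₁ (i≤m , m≤ℓ , _) = contradiction (i≤m , m≤ℓ) out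
      ... | inj₂ ≡0 = reflexive ≡0

      levelCoeff-odd : ∀ {m} → even (ℓ ∸ m) ≡ false → levelCoeff m ≈ 0#
      levelCoeff-odd {m} odd with levelCoeff-cases m
      ... | inj₁ (_ , _ , ≡sign) = trans (reflexive ≡sign) (chainSign-odd (ℓ ∸ m) odd)
      ... | inj₂ ≡0 = reflexive ≡0

      levelCoeff-step : ∀ {m} → i ≤ m → suc (suc m) ≤ ℓ → levelCoeff m ≈ - levelCoeff (suc (suc m))
      levelCoeff-step {m} i≤m 2+m≤ℓ = begin
        levelCoeff m                  ≡⟨ levelCoeff-in i≤m (≤-trans (n≤1+n m) (≤-trans (n≤1+n (suc m)) 2+m≤ℓ)) ⟩
        chainSign (ℓ ∸ m)             ≡⟨ ≡.cong chainSign (∸≡2+∸ 2+m≤ℓ) ⟩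
        - chainSign (ℓ ∸ suc (suc m)) ≡⟨ ≡.cong -_ (levelCoeff-in (≤-trans i≤m (≤-trans (n≤1+n m) (n≤1+n (suc m)))) 2+m≤ℓ) ⟨
        - levelCoeff (suc (suc m))    ∎

      pair-factorises : ∀ x′ m {c} → c < r →
        chainVector x′ m + chainVector (toggle x′ c) m
          ≈ levelCoeff m * ((factor m c 0 + factor m c 1) * ∏bits r (dropFactor c (factor m)) x′)
      pair-factorises x′ m {c} c<r = trans (sym (distribˡ _ _ _)) (*-congˡ (∏bits-toggle r (factor m) x′ c c<r))

      pair-vanishes : ∀ x′ m {c} → c < r → levelCoeff m ≈ 0# ⊎ factorKind r ℓ i c m ≡ signed →
        chainVector x′ m + chainVector (toggle x′ c) m ≈ 0#
      pair-vanishes x′ m {c} c<r zero-or-signed = trans (pair-factorises x′ m c<r) (vanish zero-or-signed)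
        where
        vanish : levelCoeff m ≈ 0# ⊎ factorKind r ℓ i c m ≡ signed →
          levelCoeff m * ((factor m c 0 + factor m c 1) * ∏bits r (dropFactor c (factor m)) x′) ≈ 0#
        vanish (inj₁ ≈0) = trans (*-congʳ ≈0) (zeroˡ _)
        vanish (inj₂ ≡signed) =
          trans (*-congˡ (trans (*-congʳ (digitSum-signed (bit x c) ≡signed)) (zeroˡ _))) (zeroʳ _)

      factor-constant : ∀ m b → factorKind r ℓ i b m ≡ constant → ∀ v → factor m b v ≡ 1#
      factor-constant m b eq v = ≡.cong (λ K → factorValue K v _) eq

      module _ (ℓ∸i-even : even (ℓ ∸ i) ≡ true) (ℓ≤r : ℓ ≤ r) where

        lowerPair-vanishes : ∀ x′ j → j < r → ¬ (i ≤ j × suc (suc j) ≤ ℓ) →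
          lowerPair chainVector x′ j ≈ 0#
        lowerPair-vanishes x′ j j<r not-inner with i ≤? j | j ≤? ℓ
        ... | no i≰j | _ = pair-vanishes x′ j j<r (inj₁ (levelCoeff-out (i≰j ∘ proj₁)))
        ... | yes _ | no j≰ℓ = pair-vanishes x′ j j<r (inj₁ (levelCoeff-out (j≰ℓ ∘ proj₂)))
        ... | yes i≤j | yes j≤ℓ with j ≟ ℓ
        ...   | yes ≡.refl = pair-vanishes x′ j j<r (inj₂ (kind-top j j<r))
        ...   | no j≢ℓ = pair-vanishes x′ j j<r (inj₁ (levelCoeff-odd ℓ∸j-odd))
          where
          1+j≡ℓ : suc j ≡ ℓ
          1+j≡ℓ with suc j ≟ ℓ
          ... | yes eq = eq
          ... | no 1+j≢ℓ = contradiction (i≤j , ≤∧≢⇒< (≤∧≢⇒< j≤ℓ j≢ℓ) 1+j≢ℓ) not-inner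
          ℓ∸j-odd : even (ℓ ∸ j) ≡ false
          ℓ∸j-odd rewrite ≡.sym 1+j≡ℓ | m+n∸n≡m 1 j = ≡.refl

        upperPair-vanishes : ∀ x′ j → j < r → ¬ (i < j × suc j ≤ ℓ) →
          upperPair chainVector x′ j ≈ 0#
        upperPair-vanishes x′ j j<r not-inner with i ≤? suc j | suc j ≤? ℓ
        ... | no i≰1+j | _ = pair-vanishes x′ (suc j) j<r (inj₁ (levelCoeff-out (i≰1+j ∘ proj₁)))
        ... | yes _ | no 1+j≰ℓ = pair-vanishes x′ (suc j) j<r (inj₁ (levelCoeff-out (1+j≰ℓ ∘ proj₂)))
        ... | yes i≤1+j | yes 1+j≤ℓ with i ≟ suc j
        ...   | yes i≡1+j = pair-vanishes x′ (suc j) j<r (inj₂ (kind-bottom (suc j) (≡.sym i≡1+j)))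
        ...   | no i≢1+j = pair-vanishes x′ (suc j) j<r (inj₁ (levelCoeff-odd ℓ∸1+j-odd))
          where
          i≡j : i ≡ j
          i≡j with i ≟ j
          ... | yes eq = eq
          ... | no i≢j = contradiction (≤∧≢⇒< (s≤s⁻¹ (≤∧≢⇒< i≤1+j i≢1+j)) i≢j , 1+j≤ℓ) not-inner
          ℓ∸1+j-odd : even (ℓ ∸ suc j) ≡ false
          ℓ∸1+j-odd = even-∸-next 1+j≤ℓ (≡.subst (λ k → even (ℓ ∸ k) ≡ true) i≡j ℓ∸i-even)

        below-r : ∀ {m} → m < ℓ → m < r
        below-r m<ℓ = ≤-trans m<ℓ ℓ≤r

        dropped-products-agree : ∀ x′ j → i ≤ j → suc (suc j) ≤ ℓ → even (ℓ ∸ j) ≡ true →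
          ∏bits r (dropFactor j (factor j)) x′ ≈ ∏bits r (dropFactor (suc j) (factor (suc (suc j)))) x′
        dropped-products-agree x′ j i≤j 2+j≤ℓ ℓ∸j-even =
          ∏bits-cong r (dropFactor j (factor j)) (dropFactor (suc j) (factor (suc (suc j)))) x′ λ b _ v →
            reflexive (same-factor b v)
          where
          j<ℓ : j < ℓ
          j<ℓ = ≤-trans (n≤1+n (suc j)) 2+j≤ℓ
          same-factor : ∀ b v → dropFactor j (factor j) b v ≡ dropFactor (suc j) (factor (suc (suc j))) b v
          same-factor b v with b ≟ j | b ≟ suc j
          ... | yes ≡.refl | _ = ≡.trans (dropFactor-at j (factor j) v) (≡.sym (≡.trans
                  (dropFactor-other (suc j) (factor (suc (suc j))) j v (<⇒≢ (n<1+n j)))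
                  (factor-constant (suc (suc j)) j kind-j v)))
            where
            kind-j : factorKind r ℓ i j (suc (suc j)) ≡ constant
            kind-j = kind-chain (suc (suc j)) i≤j j<ℓ ℓ∸j-even (dec-true (j <? suc (suc j)) (m<n⇒m<1+n (n<1+n j)))
          ... | no _ | yes ≡.refl = ≡.trans
                  (≡.trans (dropFactor-other j (factor j) (suc j) v (<⇒≢ (n<1+n j) ∘ ≡.sym))
                           (factor-constant j (suc j) kind-1+j v))
                  (≡.sym (dropFactor-at (suc j) (factor (suc (suc j))) v))
            where
            kind-1+j : factorKind r ℓ i (suc j) j ≡ constant
            kind-1+j = kind-chain j (≤-trans i≤j (n≤1+n j)) 2+j≤ℓ (even-∸-next j<ℓ ℓ∸j-even)
                         (dec-false (suc j <? j) (<-asym (n<1+n j)))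
          ... | no b≢j | no b≢1+j = ≡.trans (dropFactor-other j (factor j) b v b≢j)
                  (≡.trans (≡.cong (λ K → factorValue K v (bit x b)) (kind-level b j (suc (suc j)) (<ᵇ-skip2 b≢j b≢1+j)))
                           (≡.sym (dropFactor-other (suc j) (factor (suc (suc j))) b v b≢1+j)))

        -- At an inner level j + 1 of the chain, the pair below (level j, bit j) and the
        -- pair above (level j + 2, bit j + 1) have zero-only digit sums 1 and agreeing
        -- remaining factors, while their level coefficients have opposite signs.
        adjacent-pairs-cancel : ∀ x′ j → i ≤ j → suc (suc j) ≤ ℓ →
          lowerPair chainVector x′ j + upperPair chainVector x′ (suc j) ≈ 0#
        adjacent-pairs-cancel x′ j i≤j 2+j≤ℓ with even (ℓ ∸ j) in ℓ∸j-parity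
        ... | false = trans
          (+-cong (pair-vanishes x′ j (below-r j<ℓ) (inj₁ (levelCoeff-odd ℓ∸j-parity)))
                  (pair-vanishes x′ (suc (suc j)) (below-r 2+j≤ℓ) (inj₁ (levelCoeff-odd ℓ∸2+j-odd))))
          (+-identityʳ 0#)
          where
          j<ℓ : j < ℓ
          j<ℓ = ≤-trans (n≤1+n (suc j)) 2+j≤ℓ
          ℓ∸2+j-odd : even (ℓ ∸ suc (suc j)) ≡ false
          ℓ∸2+j-odd = ≡.trans (≡.sym (≡.trans (≡.cong even (∸≡2+∸ 2+j≤ℓ)) (even-2+ (ℓ ∸ suc (suc j)))))
                              ℓ∸j-parity
        ... | true = begin
          lowerPair chainVector x′ j + upperPair chainVector x′ (suc j)
            ≈⟨ +-cong (pair-factorises x′ j (below-r j<ℓ)) (pair-factorises x′ (suc (suc j)) (below-r 2+j≤ℓ)) ⟩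
          levelCoeff j * (σ j j * P₁) + L * (σ (suc (suc j)) (suc j) * P₂)
            ≈⟨ +-cong (*-cong (levelCoeff-step i≤j 2+j≤ℓ)
                              (*-cong (digitSum-atZero _ kind₁) (dropped-products-agree x′ j i≤j 2+j≤ℓ ℓ∸j-parity)))
                      (*-congˡ (*-congʳ (digitSum-atZero _ kind₂))) ⟩
          - L * (1# * P₂) + L * (1# * P₂)
            ≈⟨ +-congʳ (-‿distribˡ-* _ _) ⟨
          - (L * (1# * P₂)) + L * (1# * P₂)
            ≈⟨ -‿inverseˡ _ ⟩
          0# ∎
          where
          σ : ℕ → ℕ → Carrier
          σ m c = factor m c 0 + factor m c 1
          L P₁ P₂ : Carrier
          L = levelCoeff (suc (suc j))
          P₁ = ∏bits r (dropFactor j (factor j)) x′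
          P₂ = ∏bits r (dropFactor (suc j) (factor (suc (suc j)))) x′
          j<ℓ : j < ℓ
          j<ℓ = ≤-trans (n≤1+n (suc j)) 2+j≤ℓ
          kind₁ : factorKind r ℓ i j j ≡ atZero
          kind₁ = kind-chain j i≤j j<ℓ ℓ∸j-parity (dec-false (j <? j) (<-irrefl ≡.refl))
          kind₂ : factorKind r ℓ i (suc j) (suc (suc j)) ≡ atZero
          kind₂ = kind-chain (suc (suc j)) (≤-trans i≤j (n≤1+n j)) 2+j≤ℓ (even-∸-next j<ℓ ℓ∸j-parity)
                    (dec-true (suc j <? suc (suc j)) ≤-refl)

        upper-vanishes : ∀ x′ j → ¬ (i < j × suc j ≤ ℓ) →
          (if j <ᵇ r then upperPair chainVector x′ j else 0#) ≈ 0#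
        upper-vanishes x′ j not-inner with j <? r
        ... | yes j<r rewrite dec-true (j <? r) j<r = upperPair-vanishes x′ j j<r not-inner
        ... | no j≮r rewrite dec-false (j <? r) j≮r = refl

        chainVector-left-kernel : ∀ x′ j → j ≤ r → neighbourSum r chainVector x′ j ≈ 0#
        chainVector-left-kernel x′ zero _ = trans (+-identityˡ _) (upper-vanishes x′ 0 λ ())
        chainVector-left-kernel x′ (suc l) 1+l≤r with (i ≤? l) ×-dec (suc (suc l) ≤? ℓ)
        ... | yes (i≤l , 2+l≤ℓ) rewrite dec-true (suc l <? r) (below-r 2+l≤ℓ) =
          adjacent-pairs-cancel x′ l i≤l 2+l≤ℓ
        ... | no not-inner = trans
          (+-cong (lowerPair-vanishes x′ l 1+l≤r not-inner)
                  (upper-vanishes x′ (suc l) λ (i<1+l , 2+l≤ℓ) → not-inner (s≤s⁻¹ i<1+l , 2+l≤ℓ)))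
          (+-identityʳ 0#)

module Pivot where

  open Bits
  open Chain
  open import Data.Nat using (ℕ; zero; suc; _<_; _≤_; _∸_; _≟_; _<?_; _≡ᵇ_; s≤s; s≤s⁻¹)
  open import Data.Nat.Properties using (<⇒≢; ≤-refl; ≤-trans; n≤1+n; <-irrefl; ≤-<-trans; <⇒≤; ≤∧≢⇒<;
    ≤-antisym; suc-injective; ≮⇒≥; n∸n≡0; +-∸-assoc; m+n∸n≡m; ≡ᵇ⇒≡)
  open import Data.Bool using (Bool; true; false; T; if_then_else_; _∧_; _∨_)
  open import Data.Maybe using (Maybe; just; nothing; is-just)
  open import Relation.Nullary using (yes; no; contradiction)
  open import Function using (_∘_)
  open import Relation.Binary.PropositionalEquality as ≡ using (_≡_)

  -- Read downwards from level ℓ, the bits of x continue the chain by a pair 0 1 and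
  -- end it at level i either by a bit 1 (at position i - 1) or by reaching i = 0;
  -- any other pattern means that (x , ℓ) has no chain.
  chainBottom : ℕ → ℕ → Maybe ℕ
  chainBottom x zero = just zero
  chainBottom x (suc zero) = if bit x 0 ≡ᵇ 1 then just 1 else nothing
  chainBottom x (suc (suc m)) =
    if bit x (suc m) ≡ᵇ 1 then just (suc (suc m)) else if bit x m ≡ᵇ 1 then chainBottom x m else nothing

  chainDigit : ℕ → ℕ
  chainDigit n = if even n then 1 else 0

  record ChainShape (x ℓ i : ℕ) : Set where
    field
      bottom≤top  : i ≤ ℓ
      even-length : even (ℓ ∸ i) ≡ true
      alternating : ∀ b → i ≤ b → b < ℓ → bit x b ≡ chainDigit (ℓ ∸ b)
      below-bottom : ∀ b → suc b ≡ i → bit x b ≡ 1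

  ≡ᵇ-true : ∀ {m n} → (m ≡ᵇ n) ≡ true → m ≡ n
  ≡ᵇ-true {m} {n} eq = ≡ᵇ⇒≡ m n (≡.subst T (≡.sym eq) _)

  bit-≢1 : ∀ {x b} → (bit x b ≡ᵇ 1) ≡ false → bit x b ≡ 0
  bit-≢1 {x} {b} eq with bit x b | bit<2 x b
  ... | 0 | _ = ≡.refl
  bit-≢1 () | 1 | _
  ... | suc (suc _) | s≤s (s≤s ())

  empty-chain : ∀ {x ℓ} → (∀ b → suc b ≡ ℓ → bit x b ≡ 1) → ChainShape x ℓ ℓ
  empty-chain {x} {ℓ} below = record
    { bottom≤top = ≤-refl
    ; even-length = ≡.cong even (n∸n≡0 ℓ)
    ; alternating = λ b ℓ≤b b<ℓ → contradiction (≤-<-trans ℓ≤b b<ℓ) (<-irrefl ≡.refl)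
    ; below-bottom = below
    }

  chainBottom-shape : ∀ x ℓ {i} → chainBottom x ℓ ≡ just i → ChainShape x ℓ i
  chainBottom-shape x zero ≡.refl = empty-chain λ _ ()
  chainBottom-shape x (suc zero) eq with bit x 0 ≡ᵇ 1 in x₀≡1
  chainBottom-shape x (suc zero) ≡.refl | true = empty-chain λ { zero ≡.refl → ≡ᵇ-true x₀≡1 }
  chainBottom-shape x (suc (suc m)) eq with bit x (suc m) ≡ᵇ 1 in top≡1
  chainBottom-shape x (suc (suc m)) ≡.refl | true =
    empty-chain λ b 1+b≡2+m → ≡.trans (≡.cong (bit x) (suc-injective 1+b≡2+m)) (≡ᵇ-true top≡1)
  ... | false with bit x m ≡ᵇ 1 in next≡1
  ...   | true = extend (chainBottom-shape x m eq)
    where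
    extend : ∀ {i} → ChainShape x m i → ChainShape x (suc (suc m)) i
    extend {i} shape = record
      { bottom≤top = ≤-trans bottom≤top (≤-trans (n≤1+n m) (n≤1+n (suc m)))
      ; even-length = ≡.trans (≡.cong even (+-∸-assoc 2 bottom≤top)) (≡.trans (even-2+ (m ∸ i)) even-length)
      ; alternating = alternating′
      ; below-bottom = below-bottom
      }
      where
      open ChainShape shape
      alternating′ : ∀ b → i ≤ b → b < suc (suc m) → bit x b ≡ chainDigit (suc (suc m) ∸ b)
      alternating′ b i≤b b<2+m with b <? m
      ... | yes b<m = ≡.trans (alternating b i≤b b<m) (≡.cong (λ e → if e then 1 else 0) (≡.sym even-shift))
        where
        even-shift : even (suc (suc m) ∸ b) ≡ even (m ∸ b)
        even-shift = ≡.trans (≡.cong even (+-∸-assoc 2 (<⇒≤ b<m))) (even-2+ (m ∸ b))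
      ... | no b≮m with b ≟ m
      ...   | yes ≡.refl = ≡.trans (≡ᵇ-true next≡1) (≡.cong chainDigit (≡.sym (m+n∸n≡m 2 b)))
      ...   | no b≢m with ≤-antisym (s≤s⁻¹ b<2+m) (≤∧≢⇒< (≮⇒≥ b≮m) (b≢m ∘ ≡.sym))
      ...     | ≡.refl = ≡.trans (bit-≢1 {x} {suc m} top≡1) (≡.cong chainDigit (≡.sym (m+n∸n≡m 1 m)))

  isPivot : ℕ → ℕ → ℕ → Bool
  isPivot r x ℓ = ((ℓ ≡ᵇ r) ∨ (bit x ℓ ≡ᵇ 1)) ∧ is-just (chainBottom x ℓ)

  record PivotData (r x ℓ : ℕ) : Set where
    field
      bottom  : ℕ
      shape   : ChainShape x ℓ bottom
      top-bit : ℓ < r → bit x ℓ ≡ 1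

  pivot-data : ∀ r x ℓ → isPivot r x ℓ ≡ true → PivotData r x ℓ
  pivot-data r x ℓ pivot with (ℓ ≡ᵇ r) ∨ (bit x ℓ ≡ᵇ 1) in top | chainBottom x ℓ in bottom≡
  ... | true | just i = record { bottom = i ; shape = chainBottom-shape x ℓ bottom≡ ; top-bit = top-bit }
    where
    top-bit : ℓ < r → bit x ℓ ≡ 1
    top-bit ℓ<r with ℓ ≡ᵇ r in ℓ≡r
    ... | true = contradiction (≡ᵇ-true ℓ≡r) (<⇒≢ ℓ<r)
    ... | false = ≡ᵇ-true top

module PivotVector {c ℓ′} (F : Field c ℓ′) where

  open Bits
  open Chain
  open Pivot
  open DigitProducts F
  open import Data.Nat as ℕ using (ℕ; zero; suc; _<_; _≤_; _^_; _∸_; _≟_; _<?_; _≤?_; z≤n; s≤s⁻¹)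
  open import Data.Nat.Properties using (≤-refl; ≤-reflexive; ≤∧≢⇒<; n∸n≡0; +-monoʳ-<; *-monoˡ-≤; m≤m+n)
  import Data.Nat.Properties as ℕₚ
  open import Data.Bool using (true; false; if_then_else_; _xor_)
  open import Data.Fin using (Fin; toℕ)
  open import Data.Fin.Properties using (toℕ<n; toℕ-injective)
  open import Data.Product using (_×_; _,_; proj₁; proj₂)
  open import Data.Sum using (_⊎_; inj₁; inj₂)
  open import Relation.Nullary using (¬_; yes; no)
  open import Relation.Nullary.Decidable using (dec-true; dec-false; _×-dec_)
  open import Relation.Binary.PropositionalEquality as ≡ using (_≡_; _≢_)

  open Field F hiding (zero)
  open ChainVector F
  open LinearAlgebra F using (module RankBound)
  open Neighbours.Weighted F using (left-multiply)

  data Fits : Factor → ℕ → Set where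
    signed-1   : Fits signed 1
    constant-1 : Fits constant 1
    atZero-0   : Fits atZero 0
    frozen-any : ∀ {xb} → Fits frozen xb

  fits-value : ∀ {K xb} → Fits K xb → factorValue K xb xb ≈ 1#
  fits-value signed-1 = refl
  fits-value constant-1 = refl
  fits-value atZero-0 = refl
  fits-value {xb = xb} frozen-any rewrite dec-true (xb ≟ xb) ≡.refl = refl

  fits-support : ∀ {K xb} → Fits K xb → ∀ v → v < 2 → factorValue K v xb ≈ 0# ⊎ v ≤ xb
  fits-support signed-1 v v<2 = inj₂ (s≤s⁻¹ v<2)
  fits-support constant-1 v v<2 = inj₂ (s≤s⁻¹ v<2)
  fits-support atZero-0 zero _ = inj₂ z≤n
  fits-support atZero-0 (suc v) _ = inj₁ refl
  fits-support {xb = xb} frozen-any v _ with v ≟ xb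
  ... | yes v≡xb = inj₂ (≤-reflexive v≡xb)
  ... | no v≢xb rewrite dec-false (v ≟ xb) v≢xb = inj₁ refl

  module AtPivot (r x ℓ : ℕ) (pivot : PivotData r x ℓ) where

    open PivotData pivot renaming (bottom to i)
    open ChainShape shape
    open Kinds r ℓ i

    fits-chain : ∀ b → i ≤ b → b < ℓ → ∀ e → even (ℓ ∸ b) ≡ e → Fits (factorKind r ℓ i b ℓ) (bit x b)
    fits-chain b i≤b b<ℓ e parity = ≡.subst₂ Fits (≡.sym kind≡) (≡.sym bit≡) (fits e)
      where
      kind≡ : factorKind r ℓ i b ℓ ≡ (if e xor true then atZero else constant)
      kind≡ = kind-chain ℓ i≤b b<ℓ parity (dec-true (b <? ℓ) b<ℓ)
      bit≡ : bit x b ≡ (if e then 1 else 0)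
      bit≡ = ≡.trans (alternating b i≤b b<ℓ) (≡.cong (λ e → if e then 1 else 0) parity)
      fits : ∀ e → Fits (if e xor true then atZero else constant) (if e then 1 else 0)
      fits true = constant-1
      fits false = atZero-0

    fits-off-ends : ∀ b → suc b ≢ i → b ≢ ℓ ⊎ ¬ ℓ < r → Fits (factorKind r ℓ i b ℓ) (bit x b)
    fits-off-ends b 1+b≢i not-top with (i ≤? b) ×-dec (b <? ℓ)
    ... | no not-chain =
      ≡.subst (λ K → Fits K (bit x b)) (≡.sym (kind-outside ℓ 1+b≢i not-top not-chain)) frozen-any
    ... | yes (i≤b , b<ℓ) = fits-chain b i≤b b<ℓ _ ≡.refl

    fits : ∀ b → Fits (factorKind r ℓ i b ℓ) (bit x b)
    fits b with suc b ≟ i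
    ... | yes 1+b≡i = ≡.subst₂ Fits (≡.sym (kind-bottom ℓ 1+b≡i)) (≡.sym (below-bottom b 1+b≡i)) signed-1
    ... | no 1+b≢i with b ≟ ℓ | ℓ <? r
    ...   | yes ≡.refl | yes ℓ<r = ≡.subst₂ Fits (≡.sym (kind-top ℓ ℓ<r)) (≡.sym (top-bit ℓ<r)) signed-1
    ...   | no b≢ℓ | _ = fits-off-ends b 1+b≢i (inj₁ b≢ℓ)
    ...   | yes _ | no ℓ≮r = fits-off-ends b 1+b≢i (inj₂ ℓ≮r)

    Y : ℕ → ℕ → Carrier
    Y = chainVector r ℓ i x

    Y-at-pivot : Y x ℓ ≈ 1#
    Y-at-pivot = begin
      levelCoeff r ℓ i x ℓ * P ≡⟨ ≡.cong (_* P) (levelCoeff-in r ℓ i x bottom≤top ≤-refl) ⟩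
      chainSign (ℓ ∸ ℓ) * P    ≡⟨ ≡.cong (λ k → chainSign k * P) (n∸n≡0 ℓ) ⟩
      1# * P                   ≈⟨ *-identityˡ P ⟩
      P                        ≈⟨ ∏bits-one r (factor r ℓ i x ℓ) x (λ b _ → fits-value (fits b)) ⟩
      1#                       ∎
      where
      open import Relation.Binary.Reasoning.Setoid setoid
      P : Carrier
      P = ∏bits r (factor r ℓ i x ℓ) x

    Y-pivot-level : ∀ x′ → x′ < 2 ^ r → Y x′ ℓ ≈ 0# ⊎ x′ ≤ x
    Y-pivot-level x′ x′< with ∏bits-zero-or r (factor r ℓ i x ℓ) x′ (λ b → bit x′ b ≤ bit x b)
                               (λ b _ → fits-support (fits b) (bit x′ b) (bit<2 x′ b))
    ... | inj₁ ∏≈0 = inj₁ (trans (*-congˡ ∏≈0) (zeroʳ _))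
    ... | inj₂ bits≤ = inj₂ (bitwise-≤⇒≤ r x′ x x′< bits≤)

    Y-off-chain : ∀ x′ m → ¬ (i ≤ m × m ≤ ℓ) → Y x′ m ≈ 0#
    Y-off-chain x′ m off = trans (*-congʳ (levelCoeff-out r ℓ i x off)) (zeroˡ _)

  μ : ∀ r → Vertex r → ℕ
  μ r (a , l) = toℕ l ℕ.* 2 ^ r ℕ.+ toℕ a

  μ-lower-level : ∀ r {a a′ : Fin (2 ^ r)} {l l′ : Fin (suc r)} →
    toℕ l′ < toℕ l → μ r (a′ , l′) < μ r (a , l)
  μ-lower-level r {a} {a′} {l} {l′} l′<l = begin-strict
    toℕ l′ ℕ.* 2 ^ r ℕ.+ toℕ a′   <⟨ +-monoʳ-< (toℕ l′ ℕ.* 2 ^ r) (toℕ<n a′) ⟩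
    toℕ l′ ℕ.* 2 ^ r ℕ.+ 2 ^ r    ≡⟨ ℕₚ.+-comm (toℕ l′ ℕ.* 2 ^ r) (2 ^ r) ⟩
    suc (toℕ l′) ℕ.* 2 ^ r        ≤⟨ *-monoˡ-≤ (2 ^ r) l′<l ⟩
    toℕ l ℕ.* 2 ^ r               ≤⟨ m≤m+n (toℕ l ℕ.* 2 ^ r) (toℕ a) ⟩
    toℕ l ℕ.* 2 ^ r ℕ.+ toℕ a     ∎
    where open ℕₚ.≤-Reasoning

  module _ (r : ℕ) where

    open RankBound (adjMatrix F r) (μ r)

    pivotRow : ∀ (a : Fin (2 ^ r)) (l : Fin (suc r)) → isPivot r (toℕ a) (toℕ l) ≡ true → PivotRow (a , l)
    pivotRow a l is-pivot = record
      { coeff       = λ q → Y (toℕ (proj₁ q)) (toℕ (proj₂ q))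
      ; left-kernel = λ w → trans (left-multiply r Y w)
                        (chainVector-left-kernel r ℓ i x even-length ℓ≤r _ _ (s≤s⁻¹ (toℕ<n (proj₂ w))))
      ; at-pivot    = Y-at-pivot
      ; triangular  = triangular
      }
      where
      x ℓ : ℕ
      x = toℕ a
      ℓ = toℕ l
      ℓ≤r : ℓ ≤ r
      ℓ≤r = s≤s⁻¹ (toℕ<n l)
      open AtPivot r x ℓ (pivot-data r x ℓ is-pivot)
      open PivotData (pivot-data r x ℓ is-pivot) using (shape) renaming (bottom to i)
      open ChainShape shape

      triangular : ∀ q → q ≢ (a , l) →
        Y (toℕ (proj₁ q)) (toℕ (proj₂ q)) ≈ 0# ⊎ μ r q < μ r (a , l)
      triangular (a′ , l′) q≢p with (i ≤? toℕ l′) ×-dec (toℕ l′ ≤? ℓ)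
      ... | no off = inj₁ (Y-off-chain (toℕ a′) (toℕ l′) off)
      ... | yes (_ , l′≤ℓ) with toℕ l′ ≟ ℓ
      ...   | no l′≢ℓ = inj₂ (μ-lower-level r (≤∧≢⇒< l′≤ℓ l′≢ℓ))
      ...   | yes l′≡ℓ rewrite l′≡ℓ with Y-pivot-level (toℕ a′) (toℕ<n a′)
      ...     | inj₁ Y≈0 = inj₁ Y≈0
      ...     | inj₂ a′≤x = inj₂ (+-monoʳ-< (ℓ ℕ.* 2 ^ r) (≤∧≢⇒< a′≤x a′≢a))
        where
        a′≢a : toℕ a′ ≢ x
        a′≢a a′≡a = q≢p (≡.cong₂ _,_ (toℕ-injective a′≡a) (toℕ-injective l′≡ℓ))

module Count where

  open Bits
  open Pivot
  open Chain using (∸≡suc[∸suc])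
  open import Data.Nat
  open import Data.Nat.Properties
  open import Data.Bool using (Bool; true; false; not; if_then_else_; _∧_; _∨_)
  open import Data.Maybe using (just; nothing; is-just)
  open import Data.Product using (proj₁; proj₂)
  open import Function using (_∘_)
  open import Relation.Nullary.Decidable using (dec-true; dec-false)
  open import Relation.Binary.PropositionalEquality
  open import Algebra.Properties.CommutativeSemigroup +-commutativeSemigroup using (interchange)

  ∑ : ℕ → (ℕ → ℕ) → ℕ
  ∑ zero f = 0
  ∑ (suc n) f = f 0 + ∑ n (f ∘ suc)

  ∑-cong : ∀ n {f g} → (∀ x → x < n → f x ≡ g x) → ∑ n f ≡ ∑ n g
  ∑-cong zero _ = refl
  ∑-cong (suc n) f≡g = cong₂ _+_ (f≡g 0 z<s) (∑-cong n λ x x<n → f≡g (suc x) (s<s x<n))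

  ∑-+ : ∀ n f g → ∑ n (λ x → f x + g x) ≡ ∑ n f + ∑ n g
  ∑-+ zero f g = refl
  ∑-+ (suc n) f g = trans (cong (f 0 + g 0 +_) (∑-+ n (f ∘ suc) (g ∘ suc))) (interchange (f 0) (g 0) _ _)

  ∑-*ˡ : ∀ n k f → ∑ n (λ x → k * f x) ≡ k * ∑ n f
  ∑-*ˡ zero k f = sym (*-zeroʳ k)
  ∑-*ˡ (suc n) k f = trans (cong (k * f 0 +_) (∑-*ˡ n k (f ∘ suc))) (sym (*-distribˡ-+ k _ _))

  ∑-const : ∀ n k → ∑ n (λ _ → k) ≡ n * k
  ∑-const zero k = refl
  ∑-const (suc n) k = cong (k +_) (∑-const n k)

  ∑-last : ∀ n f → ∑ (suc n) f ≡ ∑ n f + f n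
  ∑-last zero f = +-comm (f 0) 0
  ∑-last (suc n) f = trans (cong (f 0 +_) (∑-last n (f ∘ suc))) (sym (+-assoc (f 0) _ _))

  ∑-split : ∀ m n f → ∑ (m + n) f ≡ ∑ m f + ∑ n (λ x → f (m + x))
  ∑-split zero n f = refl
  ∑-split (suc m) n f = trans (cong (f 0 +_) (∑-split m n (f ∘ suc))) (sym (+-assoc (f 0) _ _))

  indicator : Bool → ℕ
  indicator b = if b then 1 else 0

  count : ℕ → (ℕ → Bool) → ℕ
  count n p = ∑ n (indicator ∘ p)

  count-all : ∀ n p → (∀ x → x < n → p x ≡ true) → count n p ≡ n
  count-all n p all =
    trans (∑-cong n λ x x<n → cong indicator (all x x<n)) (trans (∑-const n 1) (*-identityʳ n))

  count-none : ∀ n p → (∀ x → x < n → p x ≡ false) → count n p ≡ 0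
  count-none n p none =
    trans (∑-cong n λ x x<n → cong indicator (none x x<n)) (trans (∑-const n 0) (*-zeroʳ n))

  count-cong : ∀ n {p q} → (∀ x → x < n → p x ≡ q x) → count n p ≡ count n q
  count-cong n p≡q = ∑-cong n λ x x<n → cong indicator (p≡q x x<n)

  count+count-not : ∀ n p → count n p + count n (not ∘ p) ≡ n
  count+count-not n p =
    trans (sym (∑-+ n _ _)) (trans (∑-cong n λ x _ → one (p x)) (trans (∑-const n 1) (*-identityʳ n)))
    where
    one : ∀ b → indicator b + indicator (not b) ≡ 1
    one true = refl
    one false = refl

  count-halves : ∀ N p → count (2 * N) p ≡ count N p + count N (λ x → p (N + x))
  count-halves N p = trans (cong (λ n → count (N + n) p) (+-identityʳ N)) (∑-split N N _)

  LowBits : ℕ → (ℕ → Bool) → Set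
  LowBits K p = ∀ x y → (∀ b → b < K → bit x b ≡ bit y b) → p x ≡ p y

  count-lift : ∀ K p → LowBits K p → ∀ d → count (2 ^ (d + K)) p ≡ 2 ^ d * count (2 ^ K) p
  count-lift K p low zero = sym (+-identityʳ _)
  count-lift K p low (suc d) = begin
    count (2 * N) p                         ≡⟨ count-halves N p ⟩
    count N p + count N (λ x → p (N + x))   ≡⟨ cong (count N p +_) (count-cong N λ x x<N → low (N + x) x (high-half x x<N)) ⟩
    count N p + count N p                   ≡⟨ cong (count N p +_) (+-identityʳ _) ⟨
    2 * count N p                           ≡⟨ cong (2 *_) (count-lift K p low d) ⟩
    2 * (2 ^ d * count (2 ^ K) p)           ≡⟨ *-assoc 2 (2 ^ d) _ ⟨
    2 ^ suc d * count (2 ^ K) p             ∎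
    where
    open ≡-Reasoning
    N : ℕ
    N = 2 ^ (d + K)
    high-half : ∀ x → x < N → ∀ b → b < K → bit (N + x) b ≡ bit x b
    high-half x x<N b b<K = proj₂ (bits-2^n+ (d + K) x x<N) b λ b≡ → <-irrefl b≡ (≤-trans b<K (m≤n+m K d))

  chainBottom-low : ∀ ℓ x y → (∀ b → b < ℓ → bit x b ≡ bit y b) →
    chainBottom x ℓ ≡ chainBottom y ℓ
  chainBottom-low zero x y _ = refl
  chainBottom-low (suc zero) x y same = cong (λ v → if v ≡ᵇ 1 then just 1 else nothing) (same 0 z<s)
  chainBottom-low (suc (suc m)) x y same =
    trans (cong₂ (λ u v → if u ≡ᵇ 1 then just (suc (suc m)) else if v ≡ᵇ 1 then chainBottom x m else nothing)
                 (same (suc m) (n<1+n (suc m))) (same m (m<n⇒m<1+n (n<1+n m))))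
          (cong (λ c → if bit y (suc m) ≡ᵇ 1 then just (suc (suc m)) else if bit y m ≡ᵇ 1 then c else nothing)
                (chainBottom-low m x y λ b b<m → same b (m<n⇒m<1+n (m<n⇒m<1+n b<m))))

  top-bit-clear : ∀ n x → x < 2 ^ n → (bit x n ≡ᵇ 1) ≡ false
  top-bit-clear n x x< = dec-false (bit x n ≟ 1) λ eq → 0≢1+n (trans (sym (bit-≥-width n x n x< ≤-refl)) eq)

  top-bit-set : ∀ n x → x < 2 ^ n → (bit (2 ^ n + x) n ≡ᵇ 1) ≡ true
  top-bit-set n x x< = dec-true (bit (2 ^ n + x) n ≟ 1) (proj₁ (bits-2^n+ n x x<))

  hasChain : ℕ → ℕ → Bool
  hasChain ℓ x = is-just (chainBottom x ℓ)

  hasChain-2^ℓ+ : ∀ ℓ x → x < 2 ^ ℓ → hasChain ℓ (2 ^ ℓ + x) ≡ hasChain ℓ x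
  hasChain-2^ℓ+ ℓ x x< =
    cong is-just (chainBottom-low ℓ (2 ^ ℓ + x) x λ b b<ℓ → proj₂ (bits-2^n+ ℓ x x<) b (<⇒≢ b<ℓ))

  hasChain-top-set : ∀ m x → x < 2 ^ suc m → hasChain (suc (suc m)) (2 ^ suc m + x) ≡ true
  hasChain-top-set m x x< rewrite top-bit-set (suc m) x x< = refl

  hasChain-top-clear : ∀ m x → x < 2 ^ suc m →
    hasChain (suc (suc m)) x ≡ is-just (if bit x m ≡ᵇ 1 then chainBottom x m else nothing)
  hasChain-top-clear m x x< rewrite top-bit-clear (suc m) x x< = refl

  -- chains ℓ = J(ℓ + 1) = (2^(ℓ+1) + (-1)^ℓ) / 3, a Jacobsthal number
  chains : ℕ → ℕ
  chains zero = 1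
  chains (suc zero) = 1
  chains (suc (suc m)) = 2 ^ suc m + chains m

  count-chains : ∀ ℓ → count (2 ^ ℓ) (hasChain ℓ) ≡ chains ℓ
  count-chains zero = refl
  count-chains (suc zero) = refl
  count-chains (suc (suc m)) = begin
    count (2 * A) f                       ≡⟨ count-halves A f ⟩
    count A f + count A (λ x → f (A + x)) ≡⟨ cong₂ _+_ lower-half upper-half ⟩
    chains m + A                          ≡⟨ +-comm (chains m) A ⟩
    chains (suc (suc m))                  ∎
    where
    open ≡-Reasoning
    A : ℕ
    A = 2 ^ suc m
    f : ℕ → Bool
    f = hasChain (suc (suc m))
    f′ : ℕ → Bool
    f′ x = is-just (if bit x m ≡ᵇ 1 then chainBottom x m else nothing)
    f′-low : ∀ x → x < 2 ^ m → f′ x ≡ false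
    f′-low x x< rewrite top-bit-clear m x x< = refl
    f′-high : ∀ x → x < 2 ^ m → f′ (2 ^ m + x) ≡ hasChain m x
    f′-high x x< rewrite top-bit-set m x x< = hasChain-2^ℓ+ m x x<
    upper-half : count A (λ x → f (A + x)) ≡ A
    upper-half = count-all A _ λ x x<A → hasChain-top-set m x x<A
    lower-half : count A f ≡ chains m
    lower-half = begin
      count A f                                     ≡⟨ count-cong A (λ x x<A → hasChain-top-clear m x x<A) ⟩
      count (2 * 2 ^ m) f′                          ≡⟨ count-halves (2 ^ m) f′ ⟩
      count (2 ^ m) f′ + count (2 ^ m) (λ x → f′ (2 ^ m + x))
        ≡⟨ cong₂ _+_ (count-none (2 ^ m) f′ f′-low) (count-cong (2 ^ m) f′-high) ⟩
      count (2 ^ m) (hasChain m)                    ≡⟨ count-chains m ⟩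
      chains m                                      ∎

  pivotsAt : ℕ → ℕ → ℕ
  pivotsAt r ℓ = count (2 ^ r) (λ x → isPivot r x ℓ)

  pivotsAt-top : ∀ r → pivotsAt r r ≡ chains r
  pivotsAt-top r =
    trans (count-cong (2 ^ r) λ x _ → cong (λ t → (t ∨ (bit x r ≡ᵇ 1)) ∧ hasChain r x) (dec-true (r ≟ r) refl))
          (count-chains r)

  pivotsAt-below : ∀ r ℓ → ℓ < r → pivotsAt r ℓ ≡ 2 ^ (r ∸ suc ℓ) * chains ℓ
  pivotsAt-below r ℓ ℓ<r = begin
    pivotsAt r ℓ                             ≡⟨ count-cong (2 ^ r) (λ x _ → not-top x) ⟩
    count (2 ^ r) p                          ≡⟨ cong (λ n → count (2 ^ n) p) (m∸n+n≡m ℓ<r) ⟨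
    count (2 ^ (r ∸ suc ℓ + suc ℓ)) p        ≡⟨ count-lift (suc ℓ) p low (r ∸ suc ℓ) ⟩
    2 ^ (r ∸ suc ℓ) * count (2 ^ suc ℓ) p    ≡⟨ cong (2 ^ (r ∸ suc ℓ) *_) base ⟩
    2 ^ (r ∸ suc ℓ) * chains ℓ               ∎
    where
    open ≡-Reasoning
    p : ℕ → Bool
    p x = (bit x ℓ ≡ᵇ 1) ∧ hasChain ℓ x
    not-top : ∀ x → isPivot r x ℓ ≡ p x
    not-top x = cong (λ t → (t ∨ (bit x ℓ ≡ᵇ 1)) ∧ hasChain ℓ x) (dec-false (ℓ ≟ r) (<⇒≢ ℓ<r))
    low : LowBits (suc ℓ) p
    low x y same = cong₂ (λ v c → (v ≡ᵇ 1) ∧ c) (same ℓ (n<1+n ℓ))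
                         (cong is-just (chainBottom-low ℓ x y λ b b<ℓ → same b (m<n⇒m<1+n b<ℓ)))
    base : count (2 ^ suc ℓ) p ≡ chains ℓ
    base = begin
      count (2 * 2 ^ ℓ) p                                  ≡⟨ count-halves (2 ^ ℓ) p ⟩
      count (2 ^ ℓ) p + count (2 ^ ℓ) (λ x → p (2 ^ ℓ + x))
        ≡⟨ cong₂ _+_ (count-none (2 ^ ℓ) p λ x x< → cong (_∧ hasChain ℓ x) (top-bit-clear ℓ x x<))
                     (count-cong (2 ^ ℓ) λ x x< → cong₂ _∧_ (top-bit-set ℓ x x<) (hasChain-2^ℓ+ ℓ x x<)) ⟩
      count (2 ^ ℓ) (hasChain ℓ)                           ≡⟨ count-chains ℓ ⟩
      chains ℓ                                             ∎

  pivots : ℕ → ℕ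
  pivots r = ∑ (suc r) (pivotsAt r)

  belowTop : ℕ → ℕ
  belowTop r = ∑ r (λ ℓ → 2 ^ (r ∸ suc ℓ) * chains ℓ)

  pivots≡ : ∀ r → pivots r ≡ belowTop r + chains r
  pivots≡ r = trans (∑-last r (pivotsAt r)) (cong₂ _+_ (∑-cong r (pivotsAt-below r)) (pivotsAt-top r))

  belowTop-suc : ∀ r → belowTop (suc r) ≡ 2 * belowTop r + chains r
  belowTop-suc r = begin
    belowTop (suc r)                                           ≡⟨ ∑-last r _ ⟩
    ∑ r (λ ℓ → 2 ^ (r ∸ ℓ) * chains ℓ) + 2 ^ (r ∸ r) * chains r
      ≡⟨ cong₂ _+_ (∑-cong r λ ℓ ℓ<r → trans (cong (λ n → 2 ^ n * chains ℓ) (∸≡suc[∸suc] ℓ<r))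
                                               (*-assoc 2 (2 ^ (r ∸ suc ℓ)) (chains ℓ)))
                   (trans (cong (λ n → 2 ^ n * chains r) (n∸n≡0 r)) (+-identityʳ (chains r))) ⟩
    ∑ r (λ ℓ → 2 * (2 ^ (r ∸ suc ℓ) * chains ℓ)) + chains r   ≡⟨ cong (_+ chains r) (∑-*ˡ r 2 _) ⟩
    2 * belowTop r + chains r                                  ∎
    where open ≡-Reasoning

module ClosedForm where

  open Count
  open import Data.Nat as ℕ using (ℕ; zero; suc; _≤_)
  open import Data.Integer as ℤ using (ℤ; +_; -_; _*_; _-_; _^_; _+_)
  import Data.Integer.Properties as ℤ
  open import Data.Integer.Tactic.RingSolver using (solve-∀)
  open import Data.Rational as ℚ using (_/_)
  import Data.Rational.Properties as ℚ
  import Data.Rational.Unnormalised as ℚᵘ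
  import Data.Rational.Unnormalised.Properties as ℚᵘ
  open import Relation.Binary.PropositionalEquality

  +[2m+n] : ∀ m n → + (2 ℕ.* m ℕ.+ n) ≡ + 2 * + m + + n
  +[2m+n] m n = trans (ℤ.pos-+ (2 ℕ.* m) n) (cong (_+ + n) (ℤ.pos-* 2 m))

  3·chains : ∀ r → + 3 * + chains r ≡ + 2 * + (2 ℕ.^ r) + (- + 1) ^ r
  3·chains zero = refl
  3·chains (suc zero) = refl
  3·chains (suc (suc r)) = begin
    + 3 * + (2 ℕ.^ suc r ℕ.+ chains r)                 ≡⟨ cong (+ 3 *_) (+[2m+n] (2 ℕ.^ r) (chains r)) ⟩
    + 3 * (+ 2 * Q + + chains r)                       ≡⟨ step₁ Q (+ chains r) ⟩
    + 6 * Q + + 3 * + chains r                         ≡⟨ cong (λ z → + 6 * Q + z) (3·chains r) ⟩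
    + 6 * Q + (+ 2 * Q + (- + 1) ^ r)                  ≡⟨ step₂ Q ((- + 1) ^ r) ⟩
    + 2 * (+ 2 * (+ 2 * Q)) + (- + 1) ^ suc (suc r)    ≡⟨ cong (λ z → + 2 * z + (- + 1) ^ suc (suc r)) 4Q ⟨
    + 2 * + (2 ℕ.^ suc (suc r)) + (- + 1) ^ suc (suc r) ∎
    where
    open ≡-Reasoning
    Q : ℤ
    Q = + (2 ℕ.^ r)
    4Q : + (2 ℕ.^ suc (suc r)) ≡ + 2 * (+ 2 * Q)
    4Q = trans (ℤ.pos-* 2 (2 ℕ.^ suc r)) (cong (+ 2 *_) (ℤ.pos-* 2 (2 ℕ.^ r)))
    step₁ : ∀ Q J → + 3 * (+ 2 * Q + J) ≡ + 6 * Q + + 3 * J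
    step₁ = solve-∀
    step₂ : ∀ Q S → + 6 * Q + (+ 2 * Q + S) ≡ + 2 * (+ 2 * (+ 2 * Q)) + (- + 1) * ((- + 1) * S)
    step₂ = solve-∀

  9·belowTop : ∀ r → + 9 * + belowTop r ≡ (+ 3 * + r + + 1) * + (2 ℕ.^ r) - (- + 1) ^ r
  9·belowTop zero = refl
  9·belowTop (suc r) = begin
    + 9 * + belowTop (suc r)                               ≡⟨ cong (λ n → + 9 * + n) (belowTop-suc r) ⟩
    + 9 * + (2 ℕ.* belowTop r ℕ.+ chains r)                ≡⟨ cong (+ 9 *_) (+[2m+n] (belowTop r) (chains r)) ⟩
    + 9 * (+ 2 * + belowTop r + + chains r)                ≡⟨ step₁ (+ belowTop r) (+ chains r) ⟩
    + 2 * (+ 9 * + belowTop r) + + 3 * (+ 3 * + chains r)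
      ≡⟨ cong₂ (λ a b → + 2 * a + + 3 * b) (9·belowTop r) (3·chains r) ⟩
    + 2 * ((+ 3 * + r + + 1) * Q - (- + 1) ^ r) + + 3 * (+ 2 * Q + (- + 1) ^ r)
      ≡⟨ step₂ (+ r) Q ((- + 1) ^ r) ⟩
    (+ 3 * (+ 1 + + r) + + 1) * (+ 2 * Q) - (- + 1) ^ suc r
      ≡⟨ cong₂ (λ a b → (+ 3 * a + + 1) * b - (- + 1) ^ suc r) (sym (ℤ.pos-+ 1 r)) (sym (ℤ.pos-* 2 (2 ℕ.^ r))) ⟩
    (+ 3 * + suc r + + 1) * + (2 ℕ.^ suc r) - (- + 1) ^ suc r ∎
    where
    open ≡-Reasoning
    Q : ℤ
    Q = + (2 ℕ.^ r)
    step₁ : ∀ T J → + 9 * (+ 2 * T + J) ≡ + 2 * (+ 9 * T) + + 3 * (+ 3 * J)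
    step₁ = solve-∀
    step₂ : ∀ R Q S → + 2 * ((+ 3 * R + + 1) * Q - S) + + 3 * (+ 2 * Q + S)
                      ≡ (+ 3 * (+ 1 + R) + + 1) * (+ 2 * Q) - (- + 1) * S
    step₂ = solve-∀

  9·pivots : ∀ r → + 9 * + pivots r ≡ (+ 3 * + r + + 7) * + (2 ℕ.^ r) + + 2 * (- + 1) ^ r
  9·pivots r = begin
    + 9 * + pivots r                                 ≡⟨ cong (λ n → + 9 * + n) (pivots≡ r) ⟩
    + 9 * + (belowTop r ℕ.+ chains r)                ≡⟨ cong (+ 9 *_) (ℤ.pos-+ (belowTop r) (chains r)) ⟩
    + 9 * (+ belowTop r + + chains r)                ≡⟨ step₁ (+ belowTop r) (+ chains r) ⟩
    + 9 * + belowTop r + + 3 * (+ 3 * + chains r)    ≡⟨ cong₂ (λ a b → a + + 3 * b) (9·belowTop r) (3·chains r) ⟩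
    (+ 3 * + r + + 1) * Q - (- + 1) ^ r + + 3 * (+ 2 * Q + (- + 1) ^ r) ≡⟨ step₂ (+ r) Q ((- + 1) ^ r) ⟩
    (+ 3 * + r + + 7) * Q + + 2 * (- + 1) ^ r        ∎
    where
    open ≡-Reasoning
    Q : ℤ
    Q = + (2 ℕ.^ r)
    step₁ : ∀ T J → + 9 * (T + J) ≡ + 9 * T + + 3 * (+ 3 * J)
    step₁ = solve-∀
    step₂ : ∀ R Q S → (+ 3 * R + + 1) * Q - S + + 3 * (+ 2 * Q + S) ≡ (+ 3 * R + + 7) * Q + + 2 * S
    step₂ = solve-∀

  /-mono-≤ : ∀ p q m n → p * + suc n ℤ.≤ q * + suc m → p / suc m ℚ.≤ q / suc n
  /-mono-≤ p q m n p*n≤q*m = ℚ.toℚᵘ-cancel-≤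
    (ℚᵘ.≤-respˡ-≃ (ℚᵘ.≃-sym (ℚ.toℚᵘ-fromℚᵘ (ℚᵘ.mkℚᵘ p m)))
      (ℚᵘ.≤-respʳ-≃ (ℚᵘ.≃-sym (ℚ.toℚᵘ-fromℚᵘ (ℚᵘ.mkℚᵘ q n))) (ℚᵘ.*≤* p*n≤q*m)))

  non-pivots-count : ∀ r n → n ℕ.+ pivots r ≡ suc r ℕ.* 2 ℕ.^ r →
    + n * + 9 ≡ (+ 2 * (+ ((3 ℕ.* r ℕ.+ 1) ℕ.* 2 ℕ.^ r) - (- + 1) ^ r)) * + 1
  non-pivots-count r n total = begin
    + n * + 9                                                       ≡⟨ step₁ (+ n) (+ pivots r) ⟩
    + 9 * (+ n + + pivots r) - + 9 * + pivots r                     ≡⟨ cong₂ (λ a b → + 9 * a - b) all-vertices (9·pivots r) ⟩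
    + 9 * ((+ 1 + + r) * Q) - ((+ 3 * + r + + 7) * Q + + 2 * (- + 1) ^ r) ≡⟨ step₂ (+ r) Q ((- + 1) ^ r) ⟩
    (+ 2 * ((+ 3 * + r + + 1) * Q - (- + 1) ^ r)) * + 1             ≡⟨ cong (λ z → (+ 2 * (z - (- + 1) ^ r)) * + 1) [3r+1]Q ⟨
    (+ 2 * (+ ((3 ℕ.* r ℕ.+ 1) ℕ.* 2 ℕ.^ r) - (- + 1) ^ r)) * + 1   ∎
    where
    open ≡-Reasoning
    Q : ℤ
    Q = + (2 ℕ.^ r)
    all-vertices : + n + + pivots r ≡ (+ 1 + + r) * Q
    all-vertices = begin
      + n + + pivots r       ≡⟨ ℤ.pos-+ n (pivots r) ⟨
      + (n ℕ.+ pivots r)     ≡⟨ cong +_ total ⟩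
      + (suc r ℕ.* 2 ℕ.^ r)  ≡⟨ ℤ.pos-* (suc r) (2 ℕ.^ r) ⟩
      + suc r * Q            ≡⟨ cong (_* Q) (ℤ.pos-+ 1 r) ⟩
      (+ 1 + + r) * Q        ∎
    [3r+1]Q : + ((3 ℕ.* r ℕ.+ 1) ℕ.* 2 ℕ.^ r) ≡ (+ 3 * + r + + 1) * Q
    [3r+1]Q = trans (ℤ.pos-* (3 ℕ.* r ℕ.+ 1) (2 ℕ.^ r))
                    (cong (_* Q) (trans (ℤ.pos-+ (3 ℕ.* r) 1) (cong (_+ + 1) (ℤ.pos-* 3 r))))
    step₁ : ∀ N P → N * + 9 ≡ + 9 * (N + P) - + 9 * P
    step₁ = solve-∀
    step₂ : ∀ R Q S → + 9 * ((+ 1 + R) * Q) - ((+ 3 * R + + 7) * Q + + 2 * S) ≡ (+ 2 * ((+ 3 * R + + 1) * Q - S)) * + 1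
    step₂ = solve-∀

  rank-bound : ∀ r k n → k ≤ n → n ℕ.+ pivots r ≡ suc r ℕ.* 2 ℕ.^ r →
    (+ k / 1) ℚ.≤ ((+ 2 * (+ ((3 ℕ.* r ℕ.+ 1) ℕ.* 2 ℕ.^ r) - (- + 1) ^ r)) / 9)
  rank-bound r k n k≤n total = /-mono-≤ (+ k) (+ 2 * (+ ((3 ℕ.* r ℕ.+ 1) ℕ.* 2 ℕ.^ r) - (- + 1) ^ r)) 0 8
    (ℤ.≤-trans (ℤ.*-monoʳ-≤-nonNeg (+ 9) (ℤ.+≤+ k≤n)) (ℤ.≤-reflexive (non-pivots-count r n total)))

module NonPivots where

  open import Level using (Level)
  open Pivot using (isPivot)
  open Count using (∑; ∑-cong; ∑-+; ∑-const; count; count+count-not; pivots; pivotsAt; indicator)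
  open ClosedForm using (rank-bound)
  open import Data.Nat using (ℕ; _≤_)
  open import Data.Nat as ℕ using (zero; suc)
  open import Data.Nat.Properties using (+-comm)
  open import Data.Integer using (+_; -_; _*_; _-_; _^_)
  open import Data.Rational using (_/_)
  open import Data.Bool using (Bool; true; false; not; if_then_else_)
  open import Function using (_∘_)
  open import Data.Fin using (Fin; toℕ)
  open import Data.Fin as Fin using ()
  open import Data.List using (List; []; _∷_; _++_; length)
  open import Data.List.Properties using (length-++)
  open import Data.List.Membership.Propositional using (_∈_)
  open import Data.List.Relation.Unary.Any using (here)
  open import Data.List.Relation.Unary.Any.Properties using (++⁺ˡ; ++⁺ʳ)
  open import Data.Product using (_,_)
  open import Data.Sum using (_⊎_; inj₁; inj₂)
  open import Relation.Binary.PropositionalEquality as ≡ using (_≡_)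

  collect : ∀ {A : Set} n → (Fin n → List A) → List A
  collect zero f = []
  collect (suc n) f = f Fin.zero ++ collect n (λ t → f (Fin.suc t))

  ∈-collect : ∀ {A : Set} n (f : Fin n → List A) t {v} → v ∈ f t → v ∈ collect n f
  ∈-collect (suc n) f Fin.zero v∈ = ++⁺ˡ v∈
  ∈-collect (suc n) f (Fin.suc t) v∈ = ++⁺ʳ (f Fin.zero) (∈-collect n (λ t → f (Fin.suc t)) t v∈)

  length-collect : ∀ {A : Set} n (f : Fin n → List A) (h : ℕ → ℕ) →
    (∀ t → length (f t) ≡ h (toℕ t)) → length (collect n f) ≡ ∑ n h
  length-collect zero f h _ = ≡.refl
  length-collect (suc n) f h len =
    ≡.trans (length-++ (f Fin.zero))
            (≡.cong₂ ℕ._+_ (len Fin.zero) (length-collect n _ _ (λ t → len (Fin.suc t))))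

  nonPivotCell : ∀ r → Fin (2 ℕ.^ r) → Fin (suc r) → List (Vertex r)
  nonPivotCell r a l = if isPivot r (toℕ a) (toℕ l) then [] else (a , l) ∷ []

  nonPivotsAt : ∀ r → Fin (suc r) → List (Vertex r)
  nonPivotsAt r l = collect (2 ℕ.^ r) λ a → nonPivotCell r a l

  nonPivots : ∀ r → List (Vertex r)
  nonPivots r = collect (suc r) (nonPivotsAt r)

  nonPivots+pivots : ∀ r → length (nonPivots r) ℕ.+ pivots r ≡ suc r ℕ.* 2 ℕ.^ r
  nonPivots+pivots r = begin
    length (nonPivots r) ℕ.+ pivots r              ≡⟨ ≡.cong (ℕ._+ pivots r) nonPivots-length ⟩
    ∑ (suc r) nonPivotCount ℕ.+ ∑ (suc r) (pivotsAt r) ≡⟨ ∑-+ (suc r) nonPivotCount (pivotsAt r) ⟨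
    ∑ (suc r) (λ ℓ → nonPivotCount ℓ ℕ.+ pivotsAt r ℓ)  ≡⟨ ∑-cong (suc r) (λ ℓ _ → level-size ℓ) ⟩
    ∑ (suc r) (λ _ → 2 ℕ.^ r)                      ≡⟨ ∑-const (suc r) (2 ℕ.^ r) ⟩
    suc r ℕ.* 2 ℕ.^ r                              ∎
    where
    open ≡.≡-Reasoning
    pivotAt : ℕ → ℕ → Bool
    pivotAt ℓ x = isPivot r x ℓ
    nonPivotCount : ℕ → ℕ
    nonPivotCount ℓ = count (2 ℕ.^ r) (not ∘ pivotAt ℓ)
    level-size : ∀ ℓ → nonPivotCount ℓ ℕ.+ pivotsAt r ℓ ≡ 2 ℕ.^ r
    level-size ℓ = ≡.trans (+-comm (nonPivotCount ℓ) (pivotsAt r ℓ)) (count+count-not (2 ℕ.^ r) (pivotAt ℓ))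
    cell-length : ∀ a l → length (nonPivotCell r a l) ≡ indicator (not (isPivot r (toℕ a) (toℕ l)))
    cell-length a l with isPivot r (toℕ a) (toℕ l)
    ... | true = ≡.refl
    ... | false = ≡.refl
    nonPivots-length : length (nonPivots r) ≡ ∑ (suc r) nonPivotCount
    nonPivots-length = length-collect (suc r) (nonPivotsAt r) nonPivotCount λ l →
      length-collect (2 ℕ.^ r) (λ a → nonPivotCell r a l) (λ x → indicator (not (pivotAt (toℕ l) x))) λ a →
        cell-length a l

  module _ {c ℓ} (F : Field c ℓ) (r : ℕ) where

    open LinearAlgebra F using (module RankBound)
    open RankBound (adjMatrix F r) (PivotVector.μ F r)
    open PivotVector F using (pivotRow)

    nonPivot-or-pivotRow : ∀ p → p ∈ nonPivots r ⊎ PivotRow p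
    nonPivot-or-pivotRow (a , l) with isPivot r (toℕ a) (toℕ l) in pivot?
    ... | true = inj₂ (pivotRow r a l pivot?)
    ... | false = inj₁ (∈-collect (suc r) (nonPivotsAt r) l (∈-collect (2 ℕ.^ r) (λ a → nonPivotCell r a l) a a∈))
      where
      a∈ : (a , l) ∈ nonPivotCell r a l
      a∈ rewrite pivot? = here ≡.refl

open import Level using (Level)
open import Data.Nat using (ℕ; _≤_)
open import Data.Integer using (+_; -_; _*_; _-_; _^_)
open import Data.Rational using (_/_)
open import Data.List using (length)
open ClosedForm using (rank-bound)
open NonPivots using (nonPivots; nonPivots+pivots; nonPivot-or-pivotRow)

-- The bound also holds for r = 0.
proposition4p1 : ∀ {c ℓ : Level} (F : Field c ℓ) (r : ℕ) → 1 ≤ r →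
    RankAtMost F (adjMatrix F r)
      ((+ 2 * (+ ((3 Data.Nat.* r Data.Nat.+ 1) Data.Nat.* 2 Data.Nat.^ r) - (- + 1) ^ r)) / 9)
proposition4p1 F r _ k col independent =
  rank-bound r k (length (nonPivots r))
    (independent-columns≤non-pivots (nonPivots r) (nonPivot-or-pivotRow F r) k col independent)
    (nonPivots+pivots r)
  where open LinearAlgebra.RankBound F (adjMatrix F r) (PivotVector.μ F r)
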